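{- Let $N\ge 2$ and let $r_{N-1,N}(n)$ be the constant term (coefficient of $X_1^0\cdots X_N^0$) of $\big(\sigma_{N-1}(X_1+X_1^{ -1},\ldots,X_N+X_N^{ -1})\big)^n$. Then for all $n\ge 0$, $$r_{N-1,N}(2n)=\sum_{\substack{k_1,\ldots,k_N\ge 0\\ k_1+\cdots+k_N=n}}\binom{2n}{2k_1,\ldots,2k_N}\binom{2(n-k_1)}{n-k_1}\cdots\binom{2(n-k_N)}{n-k_N}.$$ Moreover, if $N$ is even then $r_{N-1,N}(2n+1)=0$ for all $n\ge0$, and if $N$ is odd then for all $n\ge 0$, $$r_{N-1,N}(2n+1)=\sum_{\substack{k_1,\ldots,k_N\ge 0\\ k_1+\cdots+k_N=n+\frac{1-N}{2}}}\binom{2n+1}{2k_1+1,\ldots,2k_N+1}\binom{2(n-k_1)}{n-k_1}\cdots\binom{2(n-k_N)}{n-k_N}.$$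
   Context: $\sigma_{N-1}$ denotes the $(N-1)$-st elementary symmetric polynomial in $N$ variables. Equivalently, $r_{N-1,N}(n)$ is the number of sequences of $n$ vectors from $\{(v_1,\ldots,v_N)\in\{ -1,0,1\}^N:|v_1|+\cdots+|v_N|=N-1\}$ summing to zero. The symbol $\binom{m}{a_1,\ldots,a_N}$ denotes the multinomial coefficient (with $a_1+\cdots+a_N=m$); an empty sum is $0$. -}

module Defs where

open import Data.Nat as ℕ using (ℕ; zero; suc; _∸_; _≤_)
open import Data.Nat.Combinatorics using (_C_)
open import Data.Integer as ℤ using (ℤ; +_; -[1+_])
open import Data.Fin using (Fin)
open import Data.Vec as Vec using (Vec; []; _∷_; replicate; zipWith; tabulate)
open import Data.Vec.Properties using (≡-dec)
open import Data.List as List using (List; []; _∷_; _++_; concatMap; filter; map; upTo)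
open import Data.Product using (_×_; _,_)
open import Relation.Nullary using (yes; no)
open import Relation.Binary.PropositionalEquality using (_≡_)
open import Data.Bool using (if_then_else_)
open import Relation.Nullary.Decidable using (⌊_⌋)

-- Laurent polynomials in N variables X₁..X_N with integer coefficients,
-- represented as formal sums (lists) of terms  c · X^e  with e ∈ ℤ^N.
-- (Not normalised; the constant term is well defined on formal sums.)

Laurent : ℕ → Set
Laurent N = List (Vec ℤ N × ℤ)

oneL : ∀ {N} → Laurent N
oneL {N} = (replicate N (+ 0) , + 1) ∷ []

zeroL : ∀ {N} → Laurent N
zeroL = []

_+L_ : ∀ {N} → Laurent N → Laurent N → Laurent N
p +L q = p ++ q

_*L_ : ∀ {N} → Laurent N → Laurent N → Laurent N
p *L q = concatMap (λ { (e , c) → map (λ { (f , d) → (zipWith ℤ._+_ e f , c ℤ.* d) }) q }) p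

_^L_ : ∀ {N} → Laurent N → ℕ → Laurent N
p ^L zero = oneL
p ^L suc n = p *L (p ^L n)

monoL : ∀ {N} → Fin N → ℤ → Laurent N
monoL i a = (tabulate (λ j → if ⌊ Data.Fin._≟_ i j ⌋ then a else + 0) , + 1) ∷ []
  where import Data.Fin

XplusXinv : ∀ {N} → Fin N → Laurent N
XplusXinv i = monoL i (+ 1) +L monoL i (-[1+ 0 ])

constTerm : ∀ {N} → Laurent N → ℤ
constTerm {N} [] = + 0
constTerm {N} ((e , c) ∷ p) with ≡-dec ℤ._≟_ e (replicate N (+ 0))
... | yes _ = c ℤ.+ constTerm p
... | no  _ = constTerm p

σ : ∀ {N} → ℕ → List (Laurent N) → Laurent N
σ zero      ys       = oneL
σ (suc k)   []       = zeroL
σ (suc k)   (y ∷ ys) = (y *L σ k ys) +L σ (suc k) ys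

args : (N : ℕ) → List (Laurent N)
args N = List.map XplusXinv (List.allFin N)

r : (N n : ℕ) → ℤ
r N n = constTerm (σ (N ∸ 1) (args N) ^L n)

-- multinomial coefficient  (m choose a₁,…,a_N) = m! / (a₁!⋯a_N!) when
-- a₁+⋯+a_N = m, and 0 otherwise; computed as a product of binomials.
multinomial : ∀ {N} → ℕ → Vec ℕ N → ℕ
multinomial zero    []       = 1
multinomial (suc m) []       = 0
multinomial m       (a ∷ as) = (m C a) ℕ.* multinomial (m ∸ a) as

boundedVecs : (N b : ℕ) → List (Vec ℕ N)
boundedVecs zero    b = [] ∷ []
boundedVecs (suc N) b = concatMap (λ k → map (k ∷_) (boundedVecs N b)) (upTo (suc b))

vsum : ∀ {N} → Vec ℕ N → ℕ
vsum = Vec.foldr _ ℕ._+_ 0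

vprod : ∀ {N} → Vec ℕ N → ℕ
vprod = Vec.foldr _ ℕ._*_ 1

lsum : List ℕ → ℕ
lsum = List.foldr ℕ._+_ 0

centralProd : ∀ {N} → ℕ → Vec ℕ N → ℕ
centralProd n k = vprod (Vec.map (λ kᵢ → (2 ℕ.* (n ∸ kᵢ)) C (n ∸ kᵢ)) k)

evenSum : (N n : ℕ) → ℕ
evenSum N n = lsum (map (λ k → multinomial (2 ℕ.* n) (Vec.map (2 ℕ.*_) k) ℕ.* centralProd n k)
                        (filter (λ k → vsum k ℕ.≟ n) (boundedVecs N n)))

-- for N = 2M+1:  Σ_{k ≥ 0, k₁+⋯+k_N = n + (1-N)/2 = n - M}
--   binom(2n+1; 2k₁+1,…,2k_N+1) ∏ binom(2(n-kᵢ), n-kᵢ)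
-- (the condition is written  k₁+⋯+k_N + M = n, so the sum is empty when n < M)
oddSum : (M n : ℕ) → ℕ
oddSum M n = lsum (map (λ k → multinomial (suc (2 ℕ.* n)) (Vec.map (λ kᵢ → suc (2 ℕ.* kᵢ)) k) ℕ.* centralProd n k)
                       (filter (λ k → (vsum k ℕ.+ M) ℕ.≟ n) (boundedVecs (suc (2 ℕ.* M)) n)))

-- Write Q_N and P_N for σ_{N-1} and σ_N of X₁+X₁⁻¹, …, X_N+X_N⁻¹, and Y = X₁+X₁⁻¹. Splitting off
-- the first variable gives Q_{N+1} = P_N + Y Q_N and P_{N+1} = Y P_N, with Q_N and P_N now taken in
-- the remaining variables. Expanding (P_N + Y Q_N)^b (Y P_N)^a binomially and using that the constant
-- term of a product of a polynomial in X₁ and one in the other variables is the product of their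
-- constant terms, induction on N shows that the constant term of Q_N^b P_N^a is
--   Σ_{v₁+⋯+v_N = b} (b; v₁,…,v_N) ∏ᵢ w(b − vᵢ + a),
-- where w(m), the constant term of Y^m, is binom(m, m/2) for even m and 0 for odd m. Taking a = 0
-- and b = n gives r_{N-1,N}(n), and only compositions with every n − vᵢ even contribute: vᵢ = 2kᵢ
-- when n is even, vᵢ = 2kᵢ + 1 when n is odd, and for odd n this forces N to be odd.

module Submission where

open import Defs

open import Algebra.Bundles using (CommutativeSemiring)
import Algebra.Properties.CommutativeSemigroup as CommSemigroupProperties
import Algebra.Properties.CommutativeSemiring.Binomial as Binomial
import Algebra.Properties.CommutativeSemiring.Exp as CommExp
import Algebra.Properties.Semiring.Exp as Exp
import Algebra.Properties.Semiring.Mult as Mult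
import Algebra.Properties.Semiring.Sum as Sum
open import Data.Bool using (if_then_else_)
open import Data.Fin as Fin using (Fin; zero; suc; toℕ)
open import Data.Integer as ℤ using (ℤ; -[1+_]; 0ℤ; 1ℤ)
import Data.Integer.Properties as ℤP
open import Data.List as List using (List; []; _∷_; _++_; concatMap; map; filter)
import Data.List.Properties as ListP
open import Data.Nat as ℕ using (ℕ; zero; suc; _+_; _*_; _∸_; _≤_; _<_; z≤n; s≤s)
open import Data.Nat.Combinatorics using (_C_; nCn≡1)
open import Data.Nat.ListAction.Properties using (sum-++)
import Data.Nat.Properties as ℕP
open import Data.Nat.Tactic.RingSolver as ℕSolver using ()
open import Data.Product using (_×_; _,_; proj₁; proj₂; ∃)
open import Data.Sum using (_⊎_; inj₁; inj₂)
open import Data.Vec as Vec using (Vec; []; _∷_; replicate; zipWith)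
import Data.Vec.Properties as VecP
open VecP
  using ( ≡-dec; ∷-injective; zipWith-comm; zipWith-assoc; zipWith-identityˡ; zipWith-identityʳ
        ; zipWith-inverseˡ; zipWith-inverseʳ; tabulate-allFin; map-const)
open import Data.Vec.Relation.Unary.Any using (Any; here; there)
open import Function using (_∘_; id)
open import Relation.Binary.PropositionalEquality
  using (_≡_; _≢_; refl; sym; trans; cong; cong₂; subst; subst₂; module ≡-Reasoning)
import Relation.Binary.Reasoning.Setoid as SetoidReasoning
open import Relation.Nullary using (¬_; Dec; yes; no; contradiction)
open import Relation.Nullary.Decidable using (⌊⌋-map′)
open import Relation.Unary using (Decidable)

module ℤ+ = CommSemigroupProperties ℤP.+-commutativeSemigroup
module ℤ* = CommSemigroupProperties ℤP.*-commutativeSemigroup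
module ℕ* = CommSemigroupProperties ℕP.*-commutativeSemigroup

private
  variable
    A B : Set
    N : ℕ

sumℤ : List A → (A → ℤ) → ℤ
sumℤ []       h = 0ℤ
sumℤ (x ∷ xs) h = h x ℤ.+ sumℤ xs h

sumℤ-cong : (xs : List A) {h k : A → ℤ} → (∀ x → h x ≡ k x) → sumℤ xs h ≡ sumℤ xs k
sumℤ-cong []       h≗k = refl
sumℤ-cong (x ∷ xs) h≗k = cong₂ ℤ._+_ (h≗k x) (sumℤ-cong xs h≗k)

sumℤ-++ : (xs ys : List A) (h : A → ℤ) → sumℤ (xs ++ ys) h ≡ sumℤ xs h ℤ.+ sumℤ ys h
sumℤ-++ []       ys h = sym (ℤP.+-identityˡ _)
sumℤ-++ (x ∷ xs) ys h = trans (cong (ℤ._+_ (h x)) (sumℤ-++ xs ys h)) (sym (ℤP.+-assoc (h x) _ _))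

sumℤ-map : (φ : A → B) (xs : List A) (h : B → ℤ) → sumℤ (map φ xs) h ≡ sumℤ xs (h ∘ φ)
sumℤ-map φ []       h = refl
sumℤ-map φ (x ∷ xs) h = cong (ℤ._+_ (h (φ x))) (sumℤ-map φ xs h)

sumℤ-concatMap : (F : A → List B) (xs : List A) (h : B → ℤ) →
                 sumℤ (concatMap F xs) h ≡ sumℤ xs (λ x → sumℤ (F x) h)
sumℤ-concatMap F []       h = refl
sumℤ-concatMap F (x ∷ xs) h =
  trans (sumℤ-++ (F x) (concatMap F xs) h) (cong (ℤ._+_ (sumℤ (F x) h)) (sumℤ-concatMap F xs h))

sumℤ-zero : (xs : List A) → sumℤ xs (λ _ → 0ℤ) ≡ 0ℤ
sumℤ-zero []       = refl
sumℤ-zero (x ∷ xs) = trans (ℤP.+-identityˡ _) (sumℤ-zero xs)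

sumℤ-+ : (xs : List A) (h k : A → ℤ) → sumℤ xs (λ x → h x ℤ.+ k x) ≡ sumℤ xs h ℤ.+ sumℤ xs k
sumℤ-+ []       h k = refl
sumℤ-+ (x ∷ xs) h k = trans (cong (ℤ._+_ (h x ℤ.+ k x)) (sumℤ-+ xs h k)) (ℤ+.interchange (h x) (k x) _ _)

sumℤ-*ˡ : (c : ℤ) (xs : List A) (h : A → ℤ) → sumℤ xs (λ x → c ℤ.* h x) ≡ c ℤ.* sumℤ xs h
sumℤ-*ˡ c []       h = sym (ℤP.*-zeroʳ c)
sumℤ-*ˡ c (x ∷ xs) h = trans (cong (ℤ._+_ (c ℤ.* h x)) (sumℤ-*ˡ c xs h)) (sym (ℤP.*-distribˡ-+ c (h x) _))

sumℤ-*ʳ : (c : ℤ) (xs : List A) (h : A → ℤ) → sumℤ xs (λ x → h x ℤ.* c) ≡ sumℤ xs h ℤ.* c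
sumℤ-*ʳ c xs h = trans (sumℤ-cong xs (λ x → ℤP.*-comm (h x) c)) (trans (sumℤ-*ˡ c xs h) (ℤP.*-comm c _))

sumℤ-comm : (xs : List A) (ys : List B) (h : A → B → ℤ) →
            sumℤ xs (λ x → sumℤ ys (h x)) ≡ sumℤ ys (λ y → sumℤ xs (λ x → h x y))
sumℤ-comm []       ys h = sym (sumℤ-zero ys)
sumℤ-comm (x ∷ xs) ys h = trans (cong (ℤ._+_ (sumℤ ys (h x))) (sumℤ-comm xs ys h)) (sym (sumℤ-+ ys (h x) _))

sumℤ-product : (xs : List A) (ys : List B) (f : A → ℤ) (g : B → ℤ) →
               sumℤ xs (λ x → sumℤ ys (λ y → f x ℤ.* g y)) ≡ sumℤ xs f ℤ.* sumℤ ys g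
sumℤ-product xs ys f g = trans (sumℤ-cong xs (λ x → sumℤ-*ˡ (f x) ys g)) (sumℤ-*ʳ (sumℤ ys g) xs f)

infixl 6 _⊕_

_⊕_ : Vec ℤ N → Vec ℤ N → Vec ℤ N
_⊕_ = zipWith ℤ._+_

⊝_ : Vec ℤ N → Vec ℤ N
⊝_ = Vec.map (ℤ.-_)

0ᵛ : Vec ℤ N
0ᵛ {N} = replicate N 0ℤ

⊕-comm : (f g : Vec ℤ N) → f ⊕ g ≡ g ⊕ f
⊕-comm = zipWith-comm ℤP.+-comm

⊕-assoc : (f g h : Vec ℤ N) → f ⊕ g ⊕ h ≡ f ⊕ (g ⊕ h)
⊕-assoc = zipWith-assoc ℤP.+-assoc

⊕-identityˡ : (f : Vec ℤ N) → 0ᵛ ⊕ f ≡ f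
⊕-identityˡ = zipWith-identityˡ ℤP.+-identityˡ

⊕-identityʳ : (f : Vec ℤ N) → f ⊕ 0ᵛ ≡ f
⊕-identityʳ = zipWith-identityʳ ℤP.+-identityʳ

⊕-⊝-cancelʳ : (f g : Vec ℤ N) → f ⊕ g ⊕ ⊝ g ≡ f
⊕-⊝-cancelʳ f g = begin
  f ⊕ g ⊕ ⊝ g     ≡⟨ ⊕-assoc f g (⊝ g) ⟩
  f ⊕ (g ⊕ ⊝ g)   ≡⟨ cong (f ⊕_) (zipWith-inverseʳ ℤP.+-inverseʳ g) ⟩
  f ⊕ 0ᵛ          ≡⟨ ⊕-identityʳ f ⟩
  f               ∎
  where open ≡-Reasoning

⊝-⊕-cancelʳ : (f g : Vec ℤ N) → f ⊕ ⊝ g ⊕ g ≡ f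
⊝-⊕-cancelʳ f g = begin
  f ⊕ ⊝ g ⊕ g     ≡⟨ ⊕-assoc f (⊝ g) g ⟩
  f ⊕ (⊝ g ⊕ g)   ≡⟨ cong (f ⊕_) (zipWith-inverseˡ ℤP.+-inverseˡ g) ⟩
  f ⊕ 0ᵛ          ≡⟨ ⊕-identityʳ f ⟩
  f               ∎
  where open ≡-Reasoning

δ : Vec ℤ N → Vec ℤ N → ℤ
δ f e with ≡-dec ℤ._≟_ f e
... | yes _ = 1ℤ
... | no  _ = 0ℤ

δ-≡ : {f e : Vec ℤ N} → f ≡ e → δ f e ≡ 1ℤ
δ-≡ {f = f} {e} f≡e with ≡-dec ℤ._≟_ f e
... | yes _   = refl
... | no  f≢e = contradiction f≡e f≢e

δ-≢ : {f e : Vec ℤ N} → ¬ f ≡ e → δ f e ≡ 0ℤ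
δ-≢ {f = f} {e} f≢e with ≡-dec ℤ._≟_ f e
... | yes f≡e = contradiction f≡e f≢e
... | no  _   = refl

δ-cong-⇔ : ∀ {M} {f e : Vec ℤ N} {f′ e′ : Vec ℤ M} →
           (f ≡ e → f′ ≡ e′) → (f′ ≡ e′ → f ≡ e) → δ f e ≡ δ f′ e′
δ-cong-⇔ {f = f} {e} to from with ≡-dec ℤ._≟_ f e
... | yes f≡e = sym (δ-≡ (to f≡e))
... | no  f≢e = sym (δ-≢ (f≢e ∘ from))

δ-shift : (f g e : Vec ℤ N) → δ (f ⊕ g) e ≡ δ f (e ⊕ ⊝ g)
δ-shift f g e = δ-cong-⇔ (λ eq → trans (sym (⊕-⊝-cancelʳ f g)) (cong (_⊕ ⊝ g) eq))
                         (λ eq → trans (cong (_⊕ g) eq) (⊝-⊕-cancelʳ e g))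

δ-∷ : (a b : ℤ) (f e : Vec ℤ N) → δ (a ∷ f) (b ∷ e) ≡ δ (a ∷ []) (b ∷ []) ℤ.* δ f e
δ-∷ a b f e = by-cases (a ℤ.≟ b)
  where
  by-cases : Dec (a ≡ b) → δ (a ∷ f) (b ∷ e) ≡ δ (a ∷ []) (b ∷ []) ℤ.* δ f e
  by-cases (no a≢b) = trans (δ-≢ (a≢b ∘ proj₁ ∘ ∷-injective))
                            (sym (cong (ℤ._* δ f e) (δ-≢ (a≢b ∘ proj₁ ∘ ∷-injective))))
  by-cases (yes a≡b) = trans (δ-cong-⇔ (proj₂ ∘ ∷-injective) (cong₂ _∷_ a≡b))
                             (sym (trans (cong (ℤ._* δ f e) (δ-≡ (cong (_∷ []) a≡b))) (ℤP.*-identityˡ (δ f e))))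

-- Laurent polynomials up to equality of coefficients

coeff : Laurent N → Vec ℤ N → ℤ
coeff p e = sumℤ p (λ (f , c) → δ f e ℤ.* c)

constTerm≡coeff : (p : Laurent N) → constTerm p ≡ coeff p 0ᵛ
constTerm≡coeff {N} [] = refl
constTerm≡coeff {N} ((f , c) ∷ p) with ≡-dec ℤ._≟_ f 0ᵛ
... | yes _ = cong₂ ℤ._+_ (sym (ℤP.*-identityˡ c)) (constTerm≡coeff p)
... | no  _ = trans (constTerm≡coeff p) (sym (ℤP.+-identityˡ _))

sumℤ-*L : (p q : Laurent N) (h : Vec ℤ N × ℤ → ℤ) →
          sumℤ (p *L q) h ≡ sumℤ p (λ (f , c) → sumℤ q (λ (g , d) → h (f ⊕ g , c ℤ.* d)))
sumℤ-*L p q h = trans (sumℤ-concatMap _ p h) (sumℤ-cong p (λ _ → sumℤ-map _ q h))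

coeff-*L : (p q : Laurent N) (e : Vec ℤ N) →
           coeff (p *L q) e ≡ sumℤ p (λ (f , c) → c ℤ.* coeff q (e ⊕ ⊝ f))
coeff-*L p q e = trans (sumℤ-*L p q _) (sumℤ-cong p λ (f , c) →
  trans (sumℤ-cong q (λ (g , d) → begin
          δ (f ⊕ g) e ℤ.* (c ℤ.* d)      ≡⟨ cong (λ x → δ x e ℤ.* (c ℤ.* d)) (⊕-comm f g) ⟩
          δ (g ⊕ f) e ℤ.* (c ℤ.* d)      ≡⟨ cong (ℤ._* (c ℤ.* d)) (δ-shift g f e) ⟩
          δ g (e ⊕ ⊝ f) ℤ.* (c ℤ.* d)    ≡⟨ ℤ*.x∙yz≈y∙xz (δ g (e ⊕ ⊝ f)) c d ⟩
          c ℤ.* (δ g (e ⊕ ⊝ f) ℤ.* d)    ∎))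
        (sumℤ-*ˡ c q _))
  where open ≡-Reasoning

infix 4 _≈_

record _≈_ (p q : Laurent N) : Set where
  constructor coeffwise
  field coeff-≡ : ∀ e → coeff p e ≡ coeff q e

open _≈_

≈-reflexive : {p q : Laurent N} → p ≡ q → p ≈ q
≈-reflexive refl = coeffwise λ _ → refl

≈-refl : {p : Laurent N} → p ≈ p
≈-refl = ≈-reflexive refl

≈-sym : {p q : Laurent N} → p ≈ q → q ≈ p
≈-sym p≈q = coeffwise λ e → sym (coeff-≡ p≈q e)

≈-trans : {p q r : Laurent N} → p ≈ q → q ≈ r → p ≈ r
≈-trans p≈q q≈r = coeffwise λ e → trans (coeff-≡ p≈q e) (coeff-≡ q≈r e)

constTerm-cong : {p q : Laurent N} → p ≈ q → constTerm p ≡ constTerm q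
constTerm-cong {p = p} {q} p≈q =
  trans (constTerm≡coeff p) (trans (coeff-≡ p≈q 0ᵛ) (sym (constTerm≡coeff q)))

constTerm-+L : (p q : Laurent N) → constTerm (p +L q) ≡ constTerm p ℤ.+ constTerm q
constTerm-+L p q = begin
  constTerm (p ++ q)                    ≡⟨ constTerm≡coeff (p ++ q) ⟩
  coeff (p ++ q) 0ᵛ                     ≡⟨ sumℤ-++ p q _ ⟩
  coeff p 0ᵛ ℤ.+ coeff q 0ᵛ             ≡⟨ sym (cong₂ ℤ._+_ (constTerm≡coeff p) (constTerm≡coeff q)) ⟩
  constTerm p ℤ.+ constTerm q           ∎
  where open ≡-Reasoning

+L-cong : {p p′ q q′ : Laurent N} → p ≈ p′ → q ≈ q′ → p +L q ≈ p′ +L q′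
+L-cong {p = p} {p′} {q} {q′} p≈p′ q≈q′ = coeffwise λ e →
  trans (sumℤ-++ p q _) (trans (cong₂ ℤ._+_ (coeff-≡ p≈p′ e) (coeff-≡ q≈q′ e)) (sym (sumℤ-++ p′ q′ _)))

+L-assoc : (p q r : Laurent N) → (p +L q) +L r ≈ p +L (q +L r)
+L-assoc p q r = ≈-reflexive (ListP.++-assoc p q r)

+L-comm : (p q : Laurent N) → p +L q ≈ q +L p
+L-comm p q = coeffwise λ e →
  trans (sumℤ-++ p q _) (trans (ℤP.+-comm (coeff p e) _) (sym (sumℤ-++ q p _)))

+L-identityˡ : (p : Laurent N) → zeroL +L p ≈ p
+L-identityˡ p = ≈-refl

+L-identityʳ : (p : Laurent N) → p +L zeroL ≈ p
+L-identityʳ p = ≈-reflexive (ListP.++-identityʳ p)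

*L-comm : (p q : Laurent N) → p *L q ≈ q *L p
*L-comm p q = coeffwise λ e → begin
  coeff (p *L q) e
    ≡⟨ sumℤ-*L p q _ ⟩
  sumℤ p (λ (f , c) → sumℤ q (λ (g , d) → δ (f ⊕ g) e ℤ.* (c ℤ.* d)))
    ≡⟨ sumℤ-comm p q _ ⟩
  sumℤ q (λ (g , d) → sumℤ p (λ (f , c) → δ (f ⊕ g) e ℤ.* (c ℤ.* d)))
    ≡⟨ sumℤ-cong q (λ (g , d) → sumℤ-cong p (λ (f , c) →
         cong₂ (λ x y → δ x e ℤ.* y) (⊕-comm f g) (ℤP.*-comm c d))) ⟩
  sumℤ q (λ (g , d) → sumℤ p (λ (f , c) → δ (g ⊕ f) e ℤ.* (d ℤ.* c)))
    ≡⟨ sym (sumℤ-*L q p _) ⟩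
  coeff (q *L p) e ∎
  where open ≡-Reasoning

*L-assoc : (p q r : Laurent N) → (p *L q) *L r ≈ p *L (q *L r)
*L-assoc p q r = coeffwise λ e → begin
  coeff ((p *L q) *L r) e
    ≡⟨ trans (sumℤ-*L (p *L q) r _) (sumℤ-*L p q _) ⟩
  sumℤ p (λ (f , c) → sumℤ q (λ (g , d) → sumℤ r (λ (h , b) →
    δ (f ⊕ g ⊕ h) e ℤ.* (c ℤ.* d ℤ.* b))))
    ≡⟨ sumℤ-cong p (λ (f , c) → sumℤ-cong q (λ (g , d) → sumℤ-cong r (λ (h , b) →
         cong₂ (λ x y → δ x e ℤ.* y) (⊕-assoc f g h) (ℤP.*-assoc c d b)))) ⟩
  sumℤ p (λ (f , c) → sumℤ q (λ (g , d) → sumℤ r (λ (h , b) →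
    δ (f ⊕ (g ⊕ h)) e ℤ.* (c ℤ.* (d ℤ.* b)))))
    ≡⟨ sym (trans (sumℤ-*L p (q *L r) _) (sumℤ-cong p (λ _ → sumℤ-*L q r _))) ⟩
  coeff (p *L (q *L r)) e ∎
  where open ≡-Reasoning

*L-congˡ : (p : Laurent N) {q q′ : Laurent N} → q ≈ q′ → p *L q ≈ p *L q′
*L-congˡ p {q} {q′} q≈q′ = coeffwise λ e →
  trans (coeff-*L p q e)
        (trans (sumℤ-cong p (λ (f , c) → cong (c ℤ.*_) (coeff-≡ q≈q′ (e ⊕ ⊝ f))))
               (sym (coeff-*L p q′ e)))

*L-cong : {p p′ q q′ : Laurent N} → p ≈ p′ → q ≈ q′ → p *L q ≈ p′ *L q′
*L-cong {p = p} {p′} {q} {q′} p≈p′ q≈q′ =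
  ≈-trans (*L-congˡ p q≈q′) (≈-trans (*L-comm p q′) (≈-trans (*L-congˡ q′ p≈p′) (*L-comm q′ p′)))

*L-identityˡ : (p : Laurent N) → oneL *L p ≈ p
*L-identityˡ p = coeffwise λ e →
  trans (sumℤ-*L oneL p _)
        (trans (ℤP.+-identityʳ _)
               (sumℤ-cong p (λ (g , d) → cong₂ (λ x y → δ x e ℤ.* y) (⊕-identityˡ g) (ℤP.*-identityˡ d))))

*L-identityʳ : (p : Laurent N) → p *L oneL ≈ p
*L-identityʳ p = ≈-trans (*L-comm p oneL) (*L-identityˡ p)

*L-zeroˡ : (p : Laurent N) → zeroL *L p ≈ zeroL
*L-zeroˡ p = ≈-refl

*L-zeroʳ : (p : Laurent N) → p *L zeroL ≈ zeroL
*L-zeroʳ p = coeffwise λ e → trans (sumℤ-*L p [] _) (sumℤ-zero p)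

*L-distribˡ-+L : (p q r : Laurent N) → p *L (q +L r) ≈ (p *L q) +L (p *L r)
*L-distribˡ-+L p q r = coeffwise λ e → begin
  coeff (p *L (q ++ r)) e
    ≡⟨ coeff-*L p (q ++ r) e ⟩
  sumℤ p (λ (f , c) → c ℤ.* coeff (q ++ r) (e ⊕ ⊝ f))
    ≡⟨ sumℤ-cong p (λ (f , c) → trans (cong (c ℤ.*_) (sumℤ-++ q r _)) (ℤP.*-distribˡ-+ c _ _)) ⟩
  sumℤ p (λ (f , c) → c ℤ.* coeff q (e ⊕ ⊝ f) ℤ.+ c ℤ.* coeff r (e ⊕ ⊝ f))
    ≡⟨ sumℤ-+ p _ _ ⟩
  sumℤ p (λ (f , c) → c ℤ.* coeff q (e ⊕ ⊝ f)) ℤ.+ sumℤ p (λ (f , c) → c ℤ.* coeff r (e ⊕ ⊝ f))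
    ≡⟨ sym (cong₂ ℤ._+_ (coeff-*L p q e) (coeff-*L p r e)) ⟩
  coeff (p *L q) e ℤ.+ coeff (p *L r) e
    ≡⟨ sym (sumℤ-++ (p *L q) (p *L r) _) ⟩
  coeff ((p *L q) ++ (p *L r)) e ∎
  where open ≡-Reasoning

*L-distribʳ-+L : (p q r : Laurent N) → (q +L r) *L p ≈ (q *L p) +L (r *L p)
*L-distribʳ-+L p q r =
  ≈-trans (*L-comm (q +L r) p) (≈-trans (*L-distribˡ-+L p q r) (+L-cong (*L-comm p q) (*L-comm p r)))

laurentSemiring : ℕ → CommutativeSemiring _ _
laurentSemiring N = record
  { Carrier = Laurent N
  ; _≈_ = _≈_
  ; _+_ = _+L_
  ; _*_ = _*L_
  ; 0# = zeroL
  ; 1# = oneL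
  ; isCommutativeSemiring = record
    { isSemiring = record
      { isSemiringWithoutAnnihilatingZero = record
        { +-isCommutativeMonoid = record
          { isMonoid = record
            { isSemigroup = record
              { isMagma = record
                { isEquivalence = record { refl = ≈-refl ; sym = ≈-sym ; trans = ≈-trans }
                ; ∙-cong = +L-cong }
              ; assoc = +L-assoc }
            ; identity = +L-identityˡ , +L-identityʳ }
          ; comm = +L-comm }
        ; *-cong = *L-cong
        ; *-assoc = *L-assoc
        ; *-identity = *L-identityˡ , *L-identityʳ
        ; distrib = *L-distribˡ-+L , *L-distribʳ-+L }
      ; zero = *L-zeroˡ , *L-zeroʳ }
    ; *-comm = *L-comm }
  }

^L-cong : {p q : Laurent N} (n : ℕ) → p ≈ q → p ^L n ≈ q ^L n
^L-cong zero    p≈q = ≈-refl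
^L-cong (suc n) p≈q = *L-cong p≈q (^L-cong n p≈q)

^L-homo-*L : (p : Laurent N) (m n : ℕ) → (p ^L m) *L (p ^L n) ≈ p ^L (m + n)
^L-homo-*L p zero    n = *L-identityˡ (p ^L n)
^L-homo-*L p (suc m) n = ≈-trans (*L-assoc p (p ^L m) (p ^L n)) (*L-congˡ p (^L-homo-*L p m n))

oneL-^L : (n : ℕ) → oneL {N} ^L n ≈ oneL
oneL-^L zero    = ≈-refl
oneL-^L (suc n) = ≈-trans (*L-identityˡ _) (oneL-^L n)

-- Monomial substitutions X^e ↦ X^(φ e)

mapExp : ∀ {M} → (Vec ℤ M → Vec ℤ N) → Laurent M → Laurent N
mapExp φ = map (λ (e , c) → (φ e , c))

record IsAdditive {M} (φ : Vec ℤ M → Vec ℤ N) : Set where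
  field
    ⊕-homo : ∀ f g → φ (f ⊕ g) ≡ φ f ⊕ φ g
    0ᵛ-homo : φ 0ᵛ ≡ 0ᵛ

open IsAdditive

module _ {M} {φ : Vec ℤ M → Vec ℤ N} (additive : IsAdditive φ) where

  mapExp-+L : (p q : Laurent M) → mapExp φ (p +L q) ≡ mapExp φ p +L mapExp φ q
  mapExp-+L p q = ListP.map-++ _ p q

  mapExp-*L : (p q : Laurent M) → mapExp φ (p *L q) ≡ mapExp φ p *L mapExp φ q
  mapExp-*L []            q = refl
  mapExp-*L ((f , c) ∷ p) q = trans (mapExp-+L _ (p *L q)) (cong₂ _++_
    (trans (sym (ListP.map-∘ q))
           (trans (ListP.map-cong (λ (g , d) → cong (_, c ℤ.* d) (⊕-homo additive f g)) q) (ListP.map-∘ q)))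
    (mapExp-*L p q))

  mapExp-oneL : mapExp φ oneL ≡ oneL
  mapExp-oneL = cong (λ e → (e , 1ℤ) ∷ []) (0ᵛ-homo additive)

  mapExp-^L : (p : Laurent M) (n : ℕ) → mapExp φ (p ^L n) ≡ mapExp φ p ^L n
  mapExp-^L p zero    = mapExp-oneL
  mapExp-^L p (suc n) = trans (mapExp-*L p (p ^L n)) (cong (mapExp φ p *L_) (mapExp-^L p n))

  σ-mapExp : (k : ℕ) (ys : List (Laurent M)) → σ k (map (mapExp φ) ys) ≡ mapExp φ (σ k ys)
  σ-mapExp zero    ys       = sym mapExp-oneL
  σ-mapExp (suc k) []       = refl
  σ-mapExp (suc k) (y ∷ ys) = begin
    (mapExp φ y *L σ k (map (mapExp φ) ys)) +L σ (suc k) (map (mapExp φ) ys)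
      ≡⟨ cong₂ (λ a b → (mapExp φ y *L a) +L b) (σ-mapExp k ys) (σ-mapExp (suc k) ys) ⟩
    (mapExp φ y *L mapExp φ (σ k ys)) +L mapExp φ (σ (suc k) ys)
      ≡⟨ cong (_+L mapExp φ (σ (suc k) ys)) (sym (mapExp-*L y (σ k ys))) ⟩
    mapExp φ (y *L σ k ys) +L mapExp φ (σ (suc k) ys)
      ≡⟨ sym (mapExp-+L (y *L σ k ys) (σ (suc k) ys)) ⟩
    mapExp φ ((y *L σ k ys) +L σ (suc k) ys) ∎
    where open ≡-Reasoning

inFirst : Vec ℤ 1 → Vec ℤ (suc N)
inFirst (a ∷ []) = a ∷ 0ᵛ

inRest : Vec ℤ N → Vec ℤ (suc N)
inRest = 0ℤ ∷_

inFirst-additive : IsAdditive (inFirst {N})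
inFirst-additive = record
  { ⊕-homo  = λ { (a ∷ []) (b ∷ []) → cong (a ℤ.+ b ∷_) (sym (⊕-identityˡ 0ᵛ)) }
  ; 0ᵛ-homo = refl }

inRest-additive : IsAdditive (inRest {N})
inRest-additive = record { ⊕-homo = λ _ _ → refl ; 0ᵛ-homo = refl }

infix 30 ↑_

↑_ : Laurent N → Laurent (suc N)
↑_ = mapExp inRest

constTerm-separate : (u : Laurent 1) (q : Laurent N) →
                     constTerm (mapExp inFirst u *L ↑ q) ≡ constTerm u ℤ.* constTerm q
constTerm-separate {N} u q = begin
  constTerm (mapExp inFirst u *L ↑ q)
    ≡⟨ constTerm≡coeff (mapExp inFirst u *L ↑ q) ⟩
  coeff (mapExp inFirst u *L ↑ q) 0ᵛ
    ≡⟨ sumℤ-*L (mapExp inFirst u) (↑ q) _ ⟩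
  sumℤ (mapExp inFirst u) (λ (f , c) → sumℤ (↑ q) (λ (g , d) → δ (f ⊕ g) 0ᵛ ℤ.* (c ℤ.* d)))
    ≡⟨ trans (sumℤ-map _ u _) (sumℤ-cong u (λ _ → sumℤ-map _ q _)) ⟩
  sumℤ u (λ (f , c) → sumℤ q (λ (g , d) → δ (inFirst f ⊕ inRest g) 0ᵛ ℤ.* (c ℤ.* d)))
    ≡⟨ sumℤ-cong u (λ (f , c) → sumℤ-cong q (λ (g , d) → factor f g c d)) ⟩
  sumℤ u (λ (f , c) → sumℤ q (λ (g , d) → (δ f 0ᵛ ℤ.* c) ℤ.* (δ g 0ᵛ ℤ.* d)))
    ≡⟨ sumℤ-product u q _ _ ⟩
  coeff u 0ᵛ ℤ.* coeff q 0ᵛ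
    ≡⟨ sym (cong₂ ℤ._*_ (constTerm≡coeff u) (constTerm≡coeff q)) ⟩
  constTerm u ℤ.* constTerm q ∎
  where
  open ≡-Reasoning
  factor : (f : Vec ℤ 1) (g : Vec ℤ N) (c d : ℤ) →
           δ (inFirst f ⊕ inRest g) 0ᵛ ℤ.* (c ℤ.* d) ≡ (δ f 0ᵛ ℤ.* c) ℤ.* (δ g 0ᵛ ℤ.* d)
  factor (a ∷ []) g c d = begin
    δ (a ℤ.+ 0ℤ ∷ 0ᵛ ⊕ g) 0ᵛ ℤ.* (c ℤ.* d)
      ≡⟨ cong (ℤ._* (c ℤ.* d)) (δ-∷ (a ℤ.+ 0ℤ) 0ℤ (0ᵛ ⊕ g) 0ᵛ) ⟩
    δ (a ℤ.+ 0ℤ ∷ []) (0ℤ ∷ []) ℤ.* δ (0ᵛ ⊕ g) 0ᵛ ℤ.* (c ℤ.* d)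
      ≡⟨ cong₂ (λ x y → δ (x ∷ []) (0ℤ ∷ []) ℤ.* δ y 0ᵛ ℤ.* (c ℤ.* d))
               (ℤP.+-identityʳ a) (⊕-identityˡ g) ⟩
    δ (a ∷ []) (0ℤ ∷ []) ℤ.* δ g 0ᵛ ℤ.* (c ℤ.* d)
      ≡⟨ ℤ*.interchange (δ (a ∷ []) (0ℤ ∷ [])) (δ g 0ᵛ) c d ⟩
    (δ (a ∷ []) (0ℤ ∷ []) ℤ.* c) ℤ.* (δ g 0ᵛ ℤ.* d) ∎

Y : Laurent 1
Y = XplusXinv zero

Q : (N : ℕ) → Laurent N
Q N = σ (N ∸ 1) (args N)

P : (N : ℕ) → Laurent N
P N = σ N (args N)

Y₁ : Laurent (suc N)
Y₁ = mapExp inFirst Y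

XplusXinv-zero : XplusXinv {suc N} zero ≡ Y₁
XplusXinv-zero = cong (λ e → (ℤ.+ 1 ∷ e , 1ℤ) ∷ (-[1+ 0 ] ∷ e , 1ℤ) ∷ []) tabulate-const
  where
  tabulate-const : ∀ {n} {x : ℤ} → Vec.tabulate {n = n} (λ _ → x) ≡ replicate n x
  tabulate-const {x = x} = trans (tabulate-allFin _) (map-const _ x)

XplusXinv-suc : (i : Fin N) → XplusXinv (suc i) ≡ ↑ XplusXinv i
XplusXinv-suc i = cong₂ (λ e e′ → (0ℤ ∷ e , 1ℤ) ∷ (0ℤ ∷ e′ , 1ℤ) ∷ [])
  (VecP.tabulate-cong (λ j → cong (λ b → if b then ℤ.+ 1 else 0ℤ) (⌊⌋-map′ _ _ (i Fin.≟ j))))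
  (VecP.tabulate-cong (λ j → cong (λ b → if b then -[1+ 0 ] else 0ℤ) (⌊⌋-map′ _ _ (i Fin.≟ j))))

args-suc : ∀ N → args (suc N) ≡ XplusXinv zero ∷ map ↑_ (args N)
args-suc N = cong (XplusXinv zero ∷_) (begin
  map XplusXinv (List.tabulate suc)          ≡⟨ ListP.map-tabulate suc XplusXinv ⟩
  List.tabulate (XplusXinv ∘ suc)            ≡⟨ ListP.tabulate-cong XplusXinv-suc ⟩
  List.tabulate (↑_ ∘ XplusXinv)             ≡⟨ sym (ListP.map-tabulate XplusXinv ↑_) ⟩
  map ↑_ (List.tabulate XplusXinv)           ≡⟨ cong (map ↑_) (sym (ListP.map-tabulate id XplusXinv)) ⟩
  map ↑_ (map XplusXinv (List.allFin N))     ∎)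
  where open ≡-Reasoning

length-args : ∀ N → List.length (args N) ≡ N
length-args N = trans (ListP.length-map XplusXinv (List.allFin N)) (ListP.length-tabulate id)

σ-vanishes : ∀ k (ys : List (Laurent N)) → List.length ys ≤ k → σ (suc k) ys ≡ zeroL
σ-vanishes k       []       _       = refl
σ-vanishes (suc k) (y ∷ ys) (s≤s |ys|≤k) =
  cong₂ _++_ (trans (cong (y *L_) (σ-vanishes k ys |ys|≤k)) (*L-[] y))
             (σ-vanishes (suc k) ys (ℕP.m≤n⇒m≤1+n |ys|≤k))
  where
  *L-[] : (p : Laurent N) → p *L [] ≡ []
  *L-[] []      = refl
  *L-[] (_ ∷ p) = *L-[] p

Q-suc : ∀ N → Q (suc (suc N)) ≡ (Y₁ *L ↑ Q (suc N)) +L ↑ P (suc N)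
Q-suc N = trans (cong (σ (suc N)) (args-suc (suc N)))
  (cong₂ _+L_ (cong₂ _*L_ XplusXinv-zero (σ-mapExp inRest-additive N (args (suc N))))
              (σ-mapExp inRest-additive (suc N) (args (suc N))))

P-suc : ∀ N → P (suc N) ≈ Y₁ *L ↑ P N
P-suc N = ≈-trans (≈-reflexive P-suc≡) (+L-identityʳ _)
  where
  P-suc≡ : P (suc N) ≡ (Y₁ *L ↑ P N) +L zeroL
  P-suc≡ = trans (cong (σ (suc N)) (args-suc N))
    (cong₂ _+L_ (cong₂ _*L_ XplusXinv-zero (σ-mapExp inRest-additive N (args N)))
                (trans (σ-mapExp inRest-additive (suc N) (args N))
                       (cong ↑_ (σ-vanishes N (args N) (ℕP.≤-reflexive (length-args N))))))

P-one : P 1 ≈ Y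
P-one = ≈-trans (+L-identityʳ (Y *L oneL)) (*L-identityʳ Y)

sumTo : ℕ → (ℕ → ℕ) → ℕ
sumTo zero    f = f 0
sumTo (suc t) f = f 0 + sumTo t (f ∘ suc)

sumTo-cong : ∀ t {f g : ℕ → ℕ} → (∀ k → k ≤ t → f k ≡ g k) → sumTo t f ≡ sumTo t g
sumTo-cong zero    f≗g = f≗g 0 z≤n
sumTo-cong (suc t) f≗g = cong₂ _+_ (f≗g 0 z≤n) (sumTo-cong t (λ k k≤t → f≗g (suc k) (s≤s k≤t)))

sumTo-zero : ∀ t {f : ℕ → ℕ} → (∀ k → k ≤ t → f k ≡ 0) → sumTo t f ≡ 0
sumTo-zero zero    f≗0 = f≗0 0 z≤n
sumTo-zero (suc t) f≗0 = cong₂ _+_ (f≗0 0 z≤n) (sumTo-zero t (λ k k≤t → f≗0 (suc k) (s≤s k≤t)))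

sumTo-single : ∀ t j {f : ℕ → ℕ} → j ≤ t → (∀ k → k ≤ t → k ≢ j → f k ≡ 0) → sumTo t f ≡ f j
sumTo-single zero    zero    _       _   = refl
sumTo-single (suc t) zero    {f} _   f≗0 =
  trans (cong (f 0 +_) (sumTo-zero t (λ k k≤t → f≗0 (suc k) (s≤s k≤t) λ ()))) (ℕP.+-identityʳ (f 0))
sumTo-single (suc t) (suc j) {f} (s≤s j≤t) f≗0 =
  trans (cong (_+ sumTo t (f ∘ suc)) (f≗0 0 z≤n λ ()))
        (sumTo-single t j j≤t (λ k k≤t k≢j → f≗0 (suc k) (s≤s k≤t) (k≢j ∘ ℕP.suc-injective)))

sumTo-*ˡ : ∀ t c (f : ℕ → ℕ) → sumTo t (λ k → c * f k) ≡ c * sumTo t f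
sumTo-*ˡ zero    c f = refl
sumTo-*ˡ (suc t) c f = trans (cong (c * f 0 +_) (sumTo-*ˡ t c (f ∘ suc))) (sym (ℕP.*-distribˡ-+ c (f 0) _))

sumTo-vanishing-tail : ∀ t d {f : ℕ → ℕ} → (∀ k → t < k → k ≤ t + d → f k ≡ 0) →
                       sumTo (t + d) f ≡ sumTo t f
sumTo-vanishing-tail zero    zero    f≗0 = refl
sumTo-vanishing-tail zero    (suc d) {f} f≗0 =
  trans (cong (f 0 +_) (sumTo-zero d (λ k k≤d → f≗0 (suc k) (s≤s z≤n) (s≤s k≤d)))) (ℕP.+-identityʳ (f 0))
sumTo-vanishing-tail (suc t) d {f} f≗0 =
  cong (f 0 +_) (sumTo-vanishing-tail t d (λ k t<k k≤t+d → f≗0 (suc k) (s≤s t<k) (s≤s k≤t+d)))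

2*suc : ∀ n → 2 * suc n ≡ suc (suc (2 * n))
2*suc n = ℕP.*-suc 2 n

sumTo-evens : ∀ s {f : ℕ → ℕ} → (∀ i → suc (2 * i) ≤ 2 * s → f (suc (2 * i)) ≡ 0) →
              sumTo (2 * s) f ≡ sumTo s (λ i → f (2 * i))
sumTo-evens zero    f-odd≡0 = refl
sumTo-evens (suc s) {f} f-odd≡0 = begin
  sumTo (2 * suc s) f
    ≡⟨ cong (λ t → sumTo t f) (2*suc s) ⟩
  f 0 + (f 1 + sumTo (2 * s) (λ k → f (suc (suc k))))
    ≡⟨ cong (λ x → f 0 + (x + sumTo (2 * s) (λ k → f (suc (suc k)))))
            (f-odd≡0 0 (subst (1 ≤_) (sym (2*suc s)) (s≤s z≤n))) ⟩
  f 0 + sumTo (2 * s) (λ k → f (suc (suc k)))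
    ≡⟨ cong (f 0 +_) (sumTo-evens s (λ i 2i<2s → trans (cong (λ k → f (suc k)) (sym (2*suc i)))
         (f-odd≡0 (suc i) (subst₂ _≤_ (cong suc (sym (2*suc i))) (sym (2*suc s)) (s≤s (s≤s 2i<2s)))))) ⟩
  f 0 + sumTo s (λ i → f (suc (suc (2 * i))))
    ≡⟨ cong (f 0 +_) (sumTo-cong s (λ i _ → cong f (sym (2*suc i)))) ⟩
  sumTo (suc s) (λ i → f (2 * i)) ∎
  where open ≡-Reasoning

even⊎odd : ∀ k → (∃ λ i → k ≡ 2 * i) ⊎ (∃ λ i → k ≡ suc (2 * i))
even⊎odd zero = inj₁ (0 , refl)
even⊎odd (suc k) with even⊎odd k
... | inj₁ (i , k≡2i)   = inj₂ (i , cong suc k≡2i)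
... | inj₂ (i , k≡1+2i) = inj₁ (suc i , trans (cong suc k≡1+2i) (sym (2*suc i)))

indicator : {P : Set} → Dec P → ℕ
indicator (yes _) = 1
indicator (no  _) = 0

indicator-yes : {P : Set} (P? : Dec P) → P → indicator P? ≡ 1
indicator-yes (yes _) _ = refl
indicator-yes (no ¬p) p = contradiction p ¬p

indicator-no : {P : Set} (P? : Dec P) → ¬ P → indicator P? ≡ 0
indicator-no (yes p) ¬p = contradiction p ¬p
indicator-no (no _)  _  = refl

indicator-cong-⇔ : {P R : Set} (P? : Dec P) (R? : Dec R) → (P → R) → (R → P) → indicator P? ≡ indicator R?
indicator-cong-⇔ (yes p) R? to _    = sym (indicator-yes R? (to p))
indicator-cong-⇔ (no ¬p) R? _  from = sym (indicator-no R? (¬p ∘ from))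

-- Closed walks on ℤ with steps ±1

closedWalks : ℕ → ℕ
closedWalks m = sumTo m (λ k → (m C k) * indicator (k ℕ.≟ m ∸ k))

k≡m∸k⇒2k≡m : ∀ {k m} → k ≤ m → k ≡ m ∸ k → 2 * k ≡ m
k≡m∸k⇒2k≡m {k} {m} k≤m k≡m∸k = begin
  2 * k       ≡⟨ cong (k +_) (ℕP.+-identityʳ k) ⟩
  k + k       ≡⟨ cong (_+ k) k≡m∸k ⟩
  m ∸ k + k   ≡⟨ ℕP.m∸n+n≡m k≤m ⟩
  m           ∎
  where open ≡-Reasoning

closedWalks-even : ∀ j → closedWalks (2 * j) ≡ (2 * j) C j
closedWalks-even j = begin
  closedWalks (2 * j)
    ≡⟨ sumTo-single (2 * j) j (ℕP.m≤n*m j 2) (λ k k≤2j k≢j →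
         trans (cong ((2 * j C k) *_) (indicator-no (k ℕ.≟ 2 * j ∸ k)
                 (k≢j ∘ ℕP.*-cancelˡ-≡ k j 2 ∘ k≡m∸k⇒2k≡m k≤2j)))
               (ℕP.*-zeroʳ (2 * j C k))) ⟩
  (2 * j C j) * indicator (j ℕ.≟ 2 * j ∸ j)
    ≡⟨ cong ((2 * j C j) *_) (indicator-yes (j ℕ.≟ 2 * j ∸ j) (sym 2j∸j≡j)) ⟩
  (2 * j C j) * 1
    ≡⟨ ℕP.*-identityʳ _ ⟩
  2 * j C j ∎
  where
  open ≡-Reasoning
  2j∸j≡j : 2 * j ∸ j ≡ j
  2j∸j≡j = trans (cong (λ n → j + n ∸ j) (ℕP.+-identityʳ j)) (ℕP.m+n∸m≡n j j)

closedWalks-odd : ∀ j → closedWalks (suc (2 * j)) ≡ 0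
closedWalks-odd j = sumTo-zero (suc (2 * j)) (λ k k≤m →
  trans (cong ((suc (2 * j) C k) *_) (indicator-no (k ℕ.≟ suc (2 * j) ∸ k)
          (λ k≡m∸k → ℕP.even≢odd k j (k≡m∸k⇒2k≡m k≤m k≡m∸k))))
        (ℕP.*-zeroʳ (suc (2 * j) C k)))

module LaurentAlgebra (N : ℕ) where

  open CommutativeSemiring (laurentSemiring N) public using (setoid; semiring; *-commutativeSemigroup)
  open Mult semiring public using (×-assoc-*) renaming (_×_ to _×ᴸ_)
  open Exp semiring public using (_^_; ^-congˡ)
  open Sum semiring public using (sum; *-distribʳ-sum)
  open Binomial (laurentSemiring N) public using (theorem; binomialExpansion; binomialTerm)
  open CommExp (laurentSemiring N) public using (^-distrib-*)
  open CommSemigroupProperties *-commutativeSemigroup public using (interchange; x∙yz≈y∙xz; xy∙z≈y∙xz)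

  module ≈-Reasoning = SetoidReasoning setoid

  ^≡^L : (p : Laurent N) (n : ℕ) → p ^ n ≡ p ^L n
  ^≡^L p zero    = refl
  ^≡^L p (suc n) = cong (p *L_) (^≡^L p n)

  constTerm-×ᴸ : ∀ n (p : Laurent N) → constTerm (n ×ᴸ p) ≡ ℤ.+ n ℤ.* constTerm p
  constTerm-×ᴸ zero    p = refl
  constTerm-×ᴸ (suc n) p = begin
    constTerm (p +L (n ×ᴸ p))                 ≡⟨ constTerm-+L p (n ×ᴸ p) ⟩
    constTerm p ℤ.+ constTerm (n ×ᴸ p)        ≡⟨ cong (ℤ._+_ (constTerm p)) (constTerm-×ᴸ n p) ⟩
    constTerm p ℤ.+ ℤ.+ n ℤ.* constTerm p
      ≡⟨ cong (ℤ._+ ℤ.+ n ℤ.* constTerm p) (sym (ℤP.*-identityˡ (constTerm p))) ⟩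
    ℤ.+ 1 ℤ.* constTerm p ℤ.+ ℤ.+ n ℤ.* constTerm p
      ≡⟨ sym (ℤP.*-distribʳ-+ (constTerm p) (ℤ.+ 1) (ℤ.+ n)) ⟩
    ℤ.+ suc n ℤ.* constTerm p                 ∎
    where open ≡-Reasoning

  constTerm-sum : ∀ b (f : Fin (suc b) → Laurent N) (F : ℕ → ℕ) →
                  (∀ k → constTerm (f k) ≡ ℤ.+ F (toℕ k)) → constTerm (sum f) ≡ ℤ.+ sumTo b F
  constTerm-sum zero    f F f≗F = trans (constTerm-+L (f zero) zeroL) (trans (ℤP.+-identityʳ _) (f≗F zero))
  constTerm-sum (suc b) f F f≗F = begin
    constTerm (f zero +L sum (f ∘ suc))
      ≡⟨ constTerm-+L (f zero) (sum (f ∘ suc)) ⟩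
    constTerm (f zero) ℤ.+ constTerm (sum (f ∘ suc))
      ≡⟨ cong₂ ℤ._+_ (f≗F zero) (constTerm-sum b (f ∘ suc) (F ∘ suc) (f≗F ∘ suc)) ⟩
    ℤ.+ F 0 ℤ.+ ℤ.+ sumTo b (F ∘ suc)
      ≡⟨ sym (ℤP.pos-+ (F 0) _) ⟩
    ℤ.+ sumTo (suc b) F ∎
    where open ≡-Reasoning

monomial₁ : ℤ → Laurent 1
monomial₁ a = ((a ∷ []) , 1ℤ) ∷ []

X-^L : ∀ k → monomial₁ (ℤ.+ 1) ^L k ≡ monomial₁ (ℤ.+ k)
X-^L zero    = refl
X-^L (suc k) = cong (monomial₁ (ℤ.+ 1) *L_) (X-^L k)

X⁻¹-^L : ∀ k → monomial₁ -[1+ 0 ] ^L k ≡ monomial₁ (ℤ.- ℤ.+ k)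
X⁻¹-^L zero    = refl
X⁻¹-^L (suc k) = trans (cong (monomial₁ -[1+ 0 ] *L_) (X⁻¹-^L k)) (cong monomial₁ (-1-k k))
  where
  -1-k : ∀ k → -[1+ 0 ] ℤ.- ℤ.+ k ≡ ℤ.- ℤ.+ suc k
  -1-k zero    = refl
  -1-k (suc k) = refl

constTerm-monomial₁ : ∀ k j → constTerm (monomial₁ (ℤ.+ k ℤ.- ℤ.+ j)) ≡ ℤ.+ indicator (k ℕ.≟ j)
constTerm-monomial₁ k j with ≡-dec ℤ._≟_ (ℤ.+ k ℤ.- ℤ.+ j ∷ []) 0ᵛ | k ℕ.≟ j
... | yes _   | yes _   = refl
... | no  _   | no  _   = refl
... | yes k-j≡0 | no k≢j = contradiction (ℤP.+-injective (ℤP.i-j≡0⇒i≡j _ _ (proj₁ (∷-injective k-j≡0)))) k≢j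
... | no  k-j≢0 | yes refl = contradiction (cong (_∷ []) (ℤP.+-inverseʳ (ℤ.+ k))) k-j≢0

constTerm-Y^L : ∀ m → constTerm (Y ^L m) ≡ ℤ.+ closedWalks m
constTerm-Y^L m = trans (constTerm-cong Y^L≈binomial)
  (constTerm-sum m (binomialTerm (monomial₁ (ℤ.+ 1)) (monomial₁ -[1+ 0 ]) m)
     (λ k → (m C k) * indicator (k ℕ.≟ m ∸ k)) constTerm-term)
  where
  open LaurentAlgebra 1
  open ≈-Reasoning
  Y^L≈binomial : Y ^L m ≈ binomialExpansion (monomial₁ (ℤ.+ 1)) (monomial₁ -[1+ 0 ]) m
  Y^L≈binomial = begin
    Y ^L m                                       ≡⟨ sym (^≡^L Y m) ⟩
    (monomial₁ (ℤ.+ 1) +L monomial₁ -[1+ 0 ]) ^ m ≈⟨ theorem m (monomial₁ (ℤ.+ 1)) (monomial₁ -[1+ 0 ]) ⟩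
    binomialExpansion (monomial₁ (ℤ.+ 1)) (monomial₁ -[1+ 0 ]) m ∎
  constTerm-term : ∀ (k : Fin (suc m)) →
    constTerm ((m C toℕ k) ×ᴸ ((monomial₁ (ℤ.+ 1) ^ toℕ k) *L (monomial₁ -[1+ 0 ] ^ (m ∸ toℕ k))))
      ≡ ℤ.+ ((m C toℕ k) * indicator (toℕ k ℕ.≟ m ∸ toℕ k))
  constTerm-term k = let i = toℕ k ; j = m ∸ toℕ k in
    trans (constTerm-×ᴸ (m C i) _)
    (trans (cong (ℤ.+ (m C i) ℤ.*_)
             (trans (cong constTerm (cong₂ _*L_ (trans (^≡^L _ i) (X-^L i)) (trans (^≡^L _ j) (X⁻¹-^L j))))
                    (constTerm-monomial₁ i j)))
           (sym (ℤP.pos-* (m C i) _)))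

ctQP : (N b a : ℕ) → ℤ
ctQP N b a = constTerm ((Q N ^L b) *L (P N ^L a))

ctQP-one : ∀ b a → ctQP 1 b a ≡ ℤ.+ closedWalks a
ctQP-one b a = trans (constTerm-cong (≈-trans (*L-cong (oneL-^L b) (^L-cong a P-one)) (*L-identityˡ (Y ^L a))))
                     (constTerm-Y^L a)

module _ {M : ℕ} where

  open LaurentAlgebra (suc M)

  QP-term-separates : ∀ k m a →
    (((↑ P M) ^ k) *L ((Y₁ *L ↑ Q M) ^ m)) *L ((Y₁ *L ↑ P M) ^ a)
      ≈ mapExp inFirst ((Y ^L m) *L (Y ^L a)) *L ↑ ((Q M ^L m) *L ((P M ^L k) *L (P M ^L a)))
  QP-term-separates k m a = begin
    (((↑ P M) ^ k) *L ((Y₁ *L ↑ Q M) ^ m)) *L ((Y₁ *L ↑ P M) ^ a)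
      ≈⟨ *L-cong (*L-congˡ ((↑ P M) ^ k) (^-distrib-* Y₁ (↑ Q M) m)) (^-distrib-* Y₁ (↑ P M) a) ⟩
    (((↑ P M) ^ k) *L ((Y₁ ^ m) *L ((↑ Q M) ^ m))) *L ((Y₁ ^ a) *L ((↑ P M) ^ a))
      ≡⟨ cong₂ _*L_ (cong₂ _*L_ (↑-^ (P M) k) (cong₂ _*L_ (Y₁-^ m) (↑-^ (Q M) m)))
                    (cong₂ _*L_ (Y₁-^ a) (↑-^ (P M) a)) ⟩
    (Pᵏ *L (Yᵐ *L Qᵐ)) *L (Yᵃ *L Pᵃ)
      ≈⟨ *L-cong (x∙yz≈y∙xz Pᵏ Yᵐ Qᵐ) (≈-refl {p = Yᵃ *L Pᵃ}) ⟩
    (Yᵐ *L (Pᵏ *L Qᵐ)) *L (Yᵃ *L Pᵃ)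
      ≈⟨ interchange Yᵐ (Pᵏ *L Qᵐ) Yᵃ Pᵃ ⟩
    (Yᵐ *L Yᵃ) *L ((Pᵏ *L Qᵐ) *L Pᵃ)
      ≈⟨ *L-congˡ (Yᵐ *L Yᵃ) (xy∙z≈y∙xz Pᵏ Qᵐ Pᵃ) ⟩
    (Yᵐ *L Yᵃ) *L (Qᵐ *L (Pᵏ *L Pᵃ))
      ≡⟨ sym (cong₂ _*L_ (mapExp-*L inFirst-additive (Y ^L m) (Y ^L a))
           (trans (mapExp-*L inRest-additive (Q M ^L m) _)
                  (cong (Qᵐ *L_) (mapExp-*L inRest-additive (P M ^L k) (P M ^L a))))) ⟩
    mapExp inFirst ((Y ^L m) *L (Y ^L a)) *L ↑ ((Q M ^L m) *L ((P M ^L k) *L (P M ^L a))) ∎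
    where
    open ≈-Reasoning
    Pᵏ Pᵃ Qᵐ Yᵐ Yᵃ : Laurent (suc M)
    Pᵏ = ↑ (P M ^L k)
    Pᵃ = ↑ (P M ^L a)
    Qᵐ = ↑ (Q M ^L m)
    Yᵐ = mapExp inFirst (Y ^L m)
    Yᵃ = mapExp inFirst (Y ^L a)
    ↑-^ : (p : Laurent M) (n : ℕ) → (↑ p) ^ n ≡ ↑ (p ^L n)
    ↑-^ p n = trans (^≡^L _ n) (sym (mapExp-^L inRest-additive p n))
    Y₁-^ : (n : ℕ) → Y₁ ^ n ≡ mapExp inFirst (Y ^L n)
    Y₁-^ n = trans (^≡^L _ n) (sym (mapExp-^L inFirst-additive Y n))

  constTerm-QP-term : ∀ k m a →
    constTerm ((((↑ P M) ^ k) *L ((Y₁ *L ↑ Q M) ^ m)) *L ((Y₁ *L ↑ P M) ^ a))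
      ≡ ℤ.+ closedWalks (m + a) ℤ.* ctQP M m (k + a)
  constTerm-QP-term k m a = begin
    constTerm ((((↑ P M) ^ k) *L ((Y₁ *L ↑ Q M) ^ m)) *L ((Y₁ *L ↑ P M) ^ a))
      ≡⟨ constTerm-cong (QP-term-separates k m a) ⟩
    constTerm (mapExp inFirst ((Y ^L m) *L (Y ^L a)) *L ↑ ((Q M ^L m) *L ((P M ^L k) *L (P M ^L a))))
      ≡⟨ constTerm-separate ((Y ^L m) *L (Y ^L a)) ((Q M ^L m) *L ((P M ^L k) *L (P M ^L a))) ⟩
    constTerm ((Y ^L m) *L (Y ^L a)) ℤ.* constTerm ((Q M ^L m) *L ((P M ^L k) *L (P M ^L a)))
      ≡⟨ cong₂ ℤ._*_ (constTerm-cong (^L-homo-*L Y m a))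
                     (constTerm-cong (*L-congˡ (Q M ^L m) (^L-homo-*L (P M) k a))) ⟩
    constTerm (Y ^L (m + a)) ℤ.* ctQP M m (k + a)
      ≡⟨ cong (ℤ._* ctQP M m (k + a)) (constTerm-Y^L (m + a)) ⟩
    ℤ.+ closedWalks (m + a) ℤ.* ctQP M m (k + a) ∎
    where open ≡-Reasoning

module _ {N : ℕ} where

  open LaurentAlgebra (suc (suc N))

  QP-binomial : ∀ b a →
    (Q (suc (suc N)) ^L b) *L (P (suc (suc N)) ^L a)
      ≈ sum (λ k → binomialTerm (↑ P (suc N)) (Y₁ *L ↑ Q (suc N)) b k *L ((Y₁ *L ↑ P (suc N)) ^ a))
  QP-binomial b a = begin
    (Q (suc (suc N)) ^L b) *L (P (suc (suc N)) ^L a)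
      ≡⟨ sym (cong₂ _*L_ (^≡^L (Q (suc (suc N))) b) (^≡^L (P (suc (suc N))) a)) ⟩
    (Q (suc (suc N)) ^ b) *L (P (suc (suc N)) ^ a)
      ≈⟨ *L-cong (^-congˡ b Q≈x+y) (^-congˡ a (P-suc (suc N))) ⟩
    ((x +L y) ^ b) *L (z ^ a)
      ≈⟨ *L-cong (theorem b x y) (≈-refl {p = z ^ a}) ⟩
    binomialExpansion x y b *L (z ^ a)
      ≈⟨ *-distribʳ-sum (z ^ a) (binomialTerm x y b) ⟩
    sum (λ k → binomialTerm x y b k *L (z ^ a)) ∎
    where
    open ≈-Reasoning
    x y z : Laurent (suc (suc N))
    x = ↑ P (suc N)
    y = Y₁ *L ↑ Q (suc N)
    z = Y₁ *L ↑ P (suc N)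
    Q≈x+y : Q (suc (suc N)) ≈ x +L y
    Q≈x+y = ≈-trans (≈-reflexive (Q-suc N)) (+L-comm y x)

-- Sums over compositions

compositionSum : ∀ N → ℕ → (Vec ℕ N → ℕ) → ℕ
compositionSum zero    zero    g = g []
compositionSum zero    (suc t) g = 0
compositionSum (suc N) t       g = sumTo t (λ k → compositionSum N (t ∸ k) (λ v → g (k ∷ v)))

vsum-∷ : ∀ {k t} (v : Vec ℕ N) → k ≤ t → vsum v ≡ t ∸ k → vsum (k ∷ v) ≡ t
vsum-∷ {k = k} v k≤t vsum≡t∸k = trans (cong (k +_) vsum≡t∸k) (ℕP.m+[n∸m]≡n k≤t)

compositionSum-cong : ∀ N t {g h : Vec ℕ N → ℕ} → (∀ v → vsum v ≡ t → g v ≡ h v) →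
                      compositionSum N t g ≡ compositionSum N t h
compositionSum-cong zero    zero    g≗h = g≗h [] refl
compositionSum-cong zero    (suc t) g≗h = refl
compositionSum-cong (suc N) t       g≗h = sumTo-cong t (λ k k≤t →
  compositionSum-cong N (t ∸ k) (λ v vsum≡t∸k → g≗h (k ∷ v) (vsum-∷ v k≤t vsum≡t∸k)))

compositionSum-*ˡ : ∀ N t c (g : Vec ℕ N → ℕ) → compositionSum N t (λ v → c * g v) ≡ c * compositionSum N t g
compositionSum-*ˡ zero    zero    c g = refl
compositionSum-*ˡ zero    (suc t) c g = sym (ℕP.*-zeroʳ c)
compositionSum-*ˡ (suc N) t       c g =
  trans (sumTo-cong t (λ k _ → compositionSum-*ˡ N (t ∸ k) c _)) (sumTo-*ˡ t c _)

compositionSum-zero : ∀ N t {g : Vec ℕ N → ℕ} → (∀ v → vsum v ≡ t → g v ≡ 0) → compositionSum N t g ≡ 0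
compositionSum-zero N t {g} g≗0 = trans (compositionSum-cong N t {h = λ v → 0 * g v} g≗0) (compositionSum-*ˡ N t 0 g)

multinomial-∷ : ∀ m a (as : Vec ℕ N) → multinomial m (a ∷ as) ≡ (m C a) * multinomial (m ∸ a) as
multinomial-∷ zero    a as = refl
multinomial-∷ (suc m) a as = refl

closedWalkProduct : ℕ → ℕ → Vec ℕ N → ℕ
closedWalkProduct b a v = vprod (Vec.map (λ x → closedWalks (b ∸ x + a)) v)

multinomialWalkSum : ∀ N → ℕ → ℕ → ℕ
multinomialWalkSum N b a = compositionSum N b (λ v → multinomial b v * closedWalkProduct b a v)

[b∸k∸x]+[k+a]≡b∸x+a : ∀ {b k x} a → k ≤ b → x ≤ b ∸ k → b ∸ k ∸ x + (k + a) ≡ b ∸ x + a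
[b∸k∸x]+[k+a]≡b∸x+a {b} {k} {x} a k≤b x≤b∸k = begin
  b ∸ k ∸ x + (k + a)   ≡⟨ sym (ℕP.+-assoc (b ∸ k ∸ x) k a) ⟩
  b ∸ k ∸ x + k + a     ≡⟨ cong (λ n → n + k + a) b∸k∸x≡b∸x∸k ⟩
  b ∸ x ∸ k + k + a     ≡⟨ cong (_+ a) (ℕP.m∸n+n≡m k≤b∸x) ⟩
  b ∸ x + a             ∎
  where
  open ≡-Reasoning
  b∸k∸x≡b∸x∸k : b ∸ k ∸ x ≡ b ∸ x ∸ k
  b∸k∸x≡b∸x∸k = trans (ℕP.∸-+-assoc b k x) (trans (cong (b ∸_) (ℕP.+-comm k x)) (sym (ℕP.∸-+-assoc b x k)))
  k≤b∸x : k ≤ b ∸ x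
  k≤b∸x = ℕP.m+n≤o⇒m≤o∸n k (subst (k + x ≤_) (ℕP.m+[n∸m]≡n k≤b) (ℕP.+-monoʳ-≤ k x≤b∸k))

closedWalkProduct-shift : ∀ {b k} a (v : Vec ℕ N) → k ≤ b → vsum v ≤ b ∸ k →
                          closedWalkProduct (b ∸ k) (k + a) v ≡ closedWalkProduct b a v
closedWalkProduct-shift a []      k≤b _ = refl
closedWalkProduct-shift a (x ∷ v) k≤b x+v≤b∸k = cong₂ _*_
  (cong closedWalks ([b∸k∸x]+[k+a]≡b∸x+a a k≤b (ℕP.m+n≤o⇒m≤o x x+v≤b∸k)))
  (closedWalkProduct-shift a v k≤b (ℕP.m+n≤o⇒n≤o x x+v≤b∸k))

multinomialWalkSum-suc : ∀ N b a → multinomialWalkSum (suc N) b a ≡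
  sumTo b (λ k → (b C k) * (closedWalks (b ∸ k + a) * multinomialWalkSum N (b ∸ k) (k + a)))
multinomialWalkSum-suc N b a = sumTo-cong b λ k k≤b → begin
  compositionSum N (b ∸ k) (λ v → multinomial b (k ∷ v) * closedWalkProduct b a (k ∷ v))
    ≡⟨ compositionSum-cong N (b ∸ k) (λ v vsum≡b∸k → split k k≤b v vsum≡b∸k) ⟩
  compositionSum N (b ∸ k) (λ v → (b C k) * (closedWalks (b ∸ k + a) *
    (multinomial (b ∸ k) v * closedWalkProduct (b ∸ k) (k + a) v)))
    ≡⟨ compositionSum-*ˡ N (b ∸ k) (b C k) _ ⟩
  (b C k) * compositionSum N (b ∸ k) (λ v → closedWalks (b ∸ k + a) *
    (multinomial (b ∸ k) v * closedWalkProduct (b ∸ k) (k + a) v))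
    ≡⟨ cong ((b C k) *_) (compositionSum-*ˡ N (b ∸ k) (closedWalks (b ∸ k + a)) _) ⟩
  (b C k) * (closedWalks (b ∸ k + a) * multinomialWalkSum N (b ∸ k) (k + a)) ∎
  where
  open ≡-Reasoning
  split : ∀ k → k ≤ b → (v : Vec ℕ N) → vsum v ≡ b ∸ k →
    multinomial b (k ∷ v) * closedWalkProduct b a (k ∷ v)
      ≡ (b C k) * (closedWalks (b ∸ k + a) * (multinomial (b ∸ k) v * closedWalkProduct (b ∸ k) (k + a) v))
  split k k≤b v vsum≡b∸k = begin
    multinomial b (k ∷ v) * (closedWalks (b ∸ k + a) * closedWalkProduct b a v)
      ≡⟨ cong (_* (closedWalks (b ∸ k + a) * closedWalkProduct b a v)) (multinomial-∷ b k v) ⟩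
    ((b C k) * multinomial (b ∸ k) v) * (closedWalks (b ∸ k + a) * closedWalkProduct b a v)
      ≡⟨ ℕ*.interchange (b C k) (multinomial (b ∸ k) v) (closedWalks (b ∸ k + a)) _ ⟩
    ((b C k) * closedWalks (b ∸ k + a)) * (multinomial (b ∸ k) v * closedWalkProduct b a v)
      ≡⟨ ℕP.*-assoc (b C k) _ _ ⟩
    (b C k) * (closedWalks (b ∸ k + a) * (multinomial (b ∸ k) v * closedWalkProduct b a v))
      ≡⟨ cong (λ n → (b C k) * (closedWalks (b ∸ k + a) * (multinomial (b ∸ k) v * n)))
              (sym (closedWalkProduct-shift a v k≤b (ℕP.≤-reflexive vsum≡b∸k))) ⟩
    (b C k) * (closedWalks (b ∸ k + a) * (multinomial (b ∸ k) v * closedWalkProduct (b ∸ k) (k + a) v)) ∎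

multinomialWalkSum-one : ∀ b a → multinomialWalkSum 1 b a ≡ closedWalks a
multinomialWalkSum-one b a = begin
  sumTo b (λ k → compositionSum 0 (b ∸ k) (λ v → multinomial b (k ∷ v) * closedWalkProduct b a (k ∷ v)))
    ≡⟨ sumTo-single b b ℕP.≤-refl (λ k k≤b k≢b →
         empty-composition (b ∸ k) (ℕP.m>n⇒m∸n≢0 (ℕP.≤∧≢⇒< k≤b k≢b))) ⟩
  compositionSum 0 (b ∸ b) (λ v → multinomial b (b ∷ v) * closedWalkProduct b a (b ∷ v))
    ≡⟨ cong (λ t → compositionSum 0 t (λ v → multinomial b (b ∷ v) * closedWalkProduct b a (b ∷ v)))
            (ℕP.n∸n≡0 b) ⟩
  multinomial b (b ∷ []) * (closedWalks (b ∸ b + a) * 1)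
    ≡⟨ cong₂ _*_ (trans (multinomial-∷ b b [])
                        (cong₂ _*_ (nCn≡1 b) (cong (λ t → multinomial t []) (ℕP.n∸n≡0 b))))
                 (trans (ℕP.*-identityʳ _) (cong (λ t → closedWalks (t + a)) (ℕP.n∸n≡0 b))) ⟩
  1 * closedWalks a
    ≡⟨ ℕP.*-identityˡ _ ⟩
  closedWalks a ∎
  where
  open ≡-Reasoning
  empty-composition : ∀ t {g : Vec ℕ 0 → ℕ} → t ≢ 0 → compositionSum 0 t g ≡ 0
  empty-composition zero    t≢0 = contradiction refl t≢0
  empty-composition (suc t) _   = refl

ctQP≡multinomialWalkSum : ∀ N b a → ctQP (suc N) b a ≡ ℤ.+ multinomialWalkSum (suc N) b a
ctQP≡multinomialWalkSum zero    b a = trans (ctQP-one b a) (cong ℤ.+_ (sym (multinomialWalkSum-one b a)))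
ctQP≡multinomialWalkSum (suc N) b a = begin
  ctQP (suc (suc N)) b a
    ≡⟨ constTerm-cong (QP-binomial b a) ⟩
  constTerm (sum (λ k → binomialTerm x y b k *L (z ^ a)))
    ≡⟨ constTerm-sum b (λ k → binomialTerm x y b k *L (z ^ a)) F constTerm-term ⟩
  ℤ.+ sumTo b F
    ≡⟨ cong ℤ.+_ (sym (multinomialWalkSum-suc (suc N) b a)) ⟩
  ℤ.+ multinomialWalkSum (suc (suc N)) b a ∎
  where
  open ≡-Reasoning
  open LaurentAlgebra (suc (suc N)) using (sum; binomialTerm; _^_; _×ᴸ_; ×-assoc-*; constTerm-sum; constTerm-×ᴸ)
  x y z : Laurent (suc (suc N))
  x = ↑ P (suc N)
  y = Y₁ *L ↑ Q (suc N)
  z = Y₁ *L ↑ P (suc N)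
  F : ℕ → ℕ
  F k = (b C k) * (closedWalks (b ∸ k + a) * multinomialWalkSum (suc N) (b ∸ k) (k + a))
  constTerm-term : ∀ k → constTerm (binomialTerm x y b k *L (z ^ a)) ≡ ℤ.+ F (toℕ k)
  constTerm-term k = let i = toℕ k ; m = b ∸ toℕ k in begin
    constTerm (((b C i) ×ᴸ ((x ^ i) *L (y ^ m))) *L (z ^ a))
      ≡⟨ constTerm-cong (×-assoc-* (b C i) ((x ^ i) *L (y ^ m)) (z ^ a)) ⟩
    constTerm ((b C i) ×ᴸ (((x ^ i) *L (y ^ m)) *L (z ^ a)))
      ≡⟨ constTerm-×ᴸ (b C i) _ ⟩
    ℤ.+ (b C i) ℤ.* constTerm (((x ^ i) *L (y ^ m)) *L (z ^ a))
      ≡⟨ cong (ℤ.+ (b C i) ℤ.*_) (constTerm-QP-term i m a) ⟩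
    ℤ.+ (b C i) ℤ.* (ℤ.+ closedWalks (m + a) ℤ.* ctQP (suc N) m (i + a))
      ≡⟨ cong (λ n → ℤ.+ (b C i) ℤ.* (ℤ.+ closedWalks (m + a) ℤ.* n)) (ctQP≡multinomialWalkSum N m (i + a)) ⟩
    ℤ.+ (b C i) ℤ.* (ℤ.+ closedWalks (m + a) ℤ.* ℤ.+ multinomialWalkSum (suc N) m (i + a))
      ≡⟨ cong (ℤ.+ (b C i) ℤ.*_) (sym (ℤP.pos-* (closedWalks (m + a)) _)) ⟩
    ℤ.+ (b C i) ℤ.* ℤ.+ (closedWalks (m + a) * multinomialWalkSum (suc N) m (i + a))
      ≡⟨ sym (ℤP.pos-* (b C i) _) ⟩
    ℤ.+ F i ∎

r≡multinomialWalkSum : ∀ N n → r (suc N) n ≡ ℤ.+ multinomialWalkSum (suc N) n 0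
r≡multinomialWalkSum N n =
  trans (constTerm-cong (≈-sym (*L-identityʳ (Q (suc N) ^L n)))) (ctQP≡multinomialWalkSum N n 0)

Odd : ℕ → Set
Odd x = ∃ λ i → x ≡ suc (2 * i)

compositionSum-double : ∀ N s {g : Vec ℕ N → ℕ} → (∀ v → vsum v ≡ 2 * s → Any Odd v → g v ≡ 0) →
                        compositionSum N (2 * s) g ≡ compositionSum N s (g ∘ Vec.map (2 *_))
compositionSum-double zero    zero    g-odd≡0 = refl
compositionSum-double zero    (suc s) g-odd≡0 = refl
compositionSum-double (suc N) s {g} g-odd≡0 = begin
  sumTo (2 * s) (λ k → compositionSum N (2 * s ∸ k) (λ v → g (k ∷ v)))
    ≡⟨ sumTo-evens s (λ i 1+2i≤2s → compositionSum-zero N _ (λ v vsum≡ →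
         g-odd≡0 _ (vsum-∷ v 1+2i≤2s vsum≡) (here (i , refl)))) ⟩
  sumTo s (λ i → compositionSum N (2 * s ∸ 2 * i) (λ v → g (2 * i ∷ v)))
    ≡⟨ sumTo-cong s (λ i i≤s →
         trans (cong (λ t → compositionSum N t (λ v → g (2 * i ∷ v))) (sym (ℕP.*-distribˡ-∸ 2 s i)))
         (compositionSum-double N (s ∸ i) (λ v vsum≡ odd → g-odd≡0 _
           (vsum-∷ v (ℕP.*-monoʳ-≤ 2 i≤s) (trans vsum≡ (ℕP.*-distribˡ-∸ 2 s i))) (there odd)))) ⟩
  sumTo s (λ i → compositionSum N (s ∸ i) (λ v → g (2 * i ∷ Vec.map (2 *_) v))) ∎
  where open ≡-Reasoning

compositionSum-odd-total : ∀ N s {g : Vec ℕ N → ℕ} → (∀ v → vsum v ≡ suc (2 * s) → Any Odd v → g v ≡ 0) →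
                           compositionSum N (suc (2 * s)) g ≡ 0
compositionSum-odd-total zero    s g-odd≡0 = refl
compositionSum-odd-total (suc N) s {g} g-odd≡0 = sumTo-zero (suc (2 * s)) first-entry
  where
  first-entry : ∀ k → k ≤ suc (2 * s) → compositionSum N (suc (2 * s) ∸ k) (λ v → g (k ∷ v)) ≡ 0
  first-entry k k≤1+2s with even⊎odd k
  ... | inj₂ (i , refl) = compositionSum-zero N _ (λ v vsum≡ → g-odd≡0 _ (vsum-∷ v k≤1+2s vsum≡) (here (i , refl)))
  ... | inj₁ (i , refl) = trans (cong (λ t → compositionSum N t (λ v → g (2 * i ∷ v))) rest-odd)
          (compositionSum-odd-total N (s ∸ i) (λ v vsum≡ odd →
            g-odd≡0 _ (vsum-∷ v k≤1+2s (trans vsum≡ (sym rest-odd))) (there odd)))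
    where
    i≤s : i ≤ s
    i≤s = ℕP.m<1+n⇒m≤n (ℕP.*-cancelˡ-< 2 i (suc s) (subst (2 * i <_) (sym (2*suc s)) (s≤s k≤1+2s)))
    rest-odd : suc (2 * s) ∸ 2 * i ≡ suc (2 * (s ∸ i))
    rest-odd = trans (ℕP.+-∸-assoc 1 (ℕP.*-monoʳ-≤ 2 i≤s)) (cong suc (sym (ℕP.*-distribˡ-∸ 2 s i)))

compositionSum-fewer-than-parts : ∀ N t {g : Vec ℕ N → ℕ} → (∀ v → vsum v ≡ t → Any (_≡ 0) v → g v ≡ 0) →
                                  t < N → compositionSum N t g ≡ 0
compositionSum-fewer-than-parts (suc N) t {g} g-zero≡0 (s≤s t≤N) = sumTo-zero t first-entry
  where
  first-entry : ∀ k → k ≤ t → compositionSum N (t ∸ k) (λ v → g (k ∷ v)) ≡ 0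
  first-entry zero    _   = compositionSum-zero N t (λ v vsum≡t → g-zero≡0 _ vsum≡t (here refl))
  first-entry (suc k) k<t = compositionSum-fewer-than-parts N (t ∸ suc k)
    (λ v vsum≡ zero∈v → g-zero≡0 _ (vsum-∷ v k<t vsum≡) (there zero∈v))
    (ℕP.<-≤-trans (ℕP.∸-monoʳ-< {o = 0} (s≤s z≤n) k<t) t≤N)

compositionSum-positive : ∀ N t {g : Vec ℕ N → ℕ} → (∀ v → vsum v ≡ t + N → Any (_≡ 0) v → g v ≡ 0) →
                          compositionSum N (t + N) g ≡ compositionSum N t (g ∘ Vec.map suc)
compositionSum-positive zero    t {g} g-zero≡0 =
  trans (cong (λ n → compositionSum 0 n g) (ℕP.+-identityʳ t)) (compositionSum-cong 0 t (λ { [] _ → refl }))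
compositionSum-positive (suc N) t {g} g-zero≡0 = begin
  compositionSum (suc N) (t + suc N) g
    ≡⟨ cong (λ n → compositionSum (suc N) n g) (ℕP.+-suc t N) ⟩
  compositionSum N (suc (t + N)) (λ v → g (0 ∷ v))
    + sumTo (t + N) (λ k → compositionSum N (t + N ∸ k) (λ v → g (suc k ∷ v)))
    ≡⟨ cong₂ _+_ (compositionSum-zero N _ (λ v vsum≡ → g-zero≡0 _ (trans vsum≡ (sym (ℕP.+-suc t N))) (here refl)))
                 (sumTo-vanishing-tail t N (λ k t<k k≤t+N → compositionSum-fewer-than-parts N _
                    (λ v vsum≡ zero∈v → g-zero≡0 _ (trans (cong suc (vsum-∷ v k≤t+N vsum≡)) (sym (ℕP.+-suc t N)))
                                                   (there zero∈v))
                    (subst (t + N ∸ k <_) (ℕP.m+n∸m≡n t N) (ℕP.∸-monoʳ-< t<k k≤t+N)))) ⟩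
  sumTo t (λ k → compositionSum N (t + N ∸ k) (λ v → g (suc k ∷ v)))
    ≡⟨ sumTo-cong t (λ k k≤t →
         trans (cong (λ n → compositionSum N n (λ v → g (suc k ∷ v))) (ℕP.+-∸-comm N k≤t))
               (compositionSum-positive N (t ∸ k) (λ v vsum≡ zero∈v →
                 g-zero≡0 _ (vsum-shift k≤t v vsum≡) (there zero∈v)))) ⟩
  compositionSum (suc N) t (g ∘ Vec.map suc) ∎
  where
  open ≡-Reasoning
  vsum-shift : ∀ {k} → k ≤ t → (v : Vec ℕ N) → vsum v ≡ t ∸ k + N → vsum (suc k ∷ v) ≡ t + suc N
  vsum-shift {k} k≤t v vsum≡ = begin
    suc (k + vsum v)        ≡⟨ cong (λ n → suc (k + n)) vsum≡ ⟩
    suc (k + (t ∸ k + N))   ≡⟨ cong suc (sym (ℕP.+-assoc k (t ∸ k) N)) ⟩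
    suc (k + (t ∸ k) + N)   ≡⟨ cong (λ n → suc (n + N)) (ℕP.m+[n∸m]≡n k≤t) ⟩
    suc (t + N)             ≡⟨ sym (ℕP.+-suc t N) ⟩
    t + suc N               ∎

lsum-filter : {P : A → Set} (P? : Decidable P) (g : A → ℕ) (xs : List A) →
              lsum (map g (filter P? xs)) ≡ lsum (map (λ x → indicator (P? x) * g x) xs)
lsum-filter P? g []       = refl
lsum-filter P? g (x ∷ xs) with P? x
... | yes _ = cong₂ _+_ (sym (ℕP.+-identityʳ (g x))) (lsum-filter P? g xs)
... | no  _ = lsum-filter P? g xs

lsum-cong : {h k : A → ℕ} (xs : List A) → (∀ x → h x ≡ k x) → lsum (map h xs) ≡ lsum (map k xs)
lsum-cong xs h≗k = cong lsum (ListP.map-cong h≗k xs)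

lsum-zero : {h : A → ℕ} (xs : List A) → (∀ x → h x ≡ 0) → lsum (map h xs) ≡ 0
lsum-zero []       h≗0 = refl
lsum-zero (x ∷ xs) h≗0 = cong₂ _+_ (h≗0 x) (lsum-zero xs h≗0)

lsum-concatMap : (h : B → ℕ) (F : A → List B) (xs : List A) →
                 lsum (map h (concatMap F xs)) ≡ lsum (map (λ x → lsum (map h (F x))) xs)
lsum-concatMap h F []       = refl
lsum-concatMap h F (x ∷ xs) = begin
  lsum (map h (F x ++ concatMap F xs))                 ≡⟨ cong lsum (ListP.map-++ h (F x) (concatMap F xs)) ⟩
  lsum (map h (F x) ++ map h (concatMap F xs))         ≡⟨ sum-++ (map h (F x)) _ ⟩
  lsum (map h (F x)) + lsum (map h (concatMap F xs))   ≡⟨ cong (lsum (map h (F x)) +_) (lsum-concatMap h F xs) ⟩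
  lsum (map h (F x)) + lsum (map (λ x → lsum (map h (F x))) xs) ∎
  where open ≡-Reasoning

lsum-applyUpTo : ∀ b (f h : ℕ → ℕ) → lsum (map f (List.applyUpTo h (suc b))) ≡ sumTo b (f ∘ h)
lsum-applyUpTo zero    f h = ℕP.+-identityʳ _
lsum-applyUpTo (suc b) f h = cong (f (h 0) +_) (lsum-applyUpTo b f (h ∘ suc))

boundedVecs-compositionSum : ∀ N b t (g : Vec ℕ N → ℕ) → t ≤ b →
  lsum (map (λ v → indicator (vsum v ℕ.≟ t) * g v) (boundedVecs N b)) ≡ compositionSum N t g
boundedVecs-compositionSum zero    b zero    g _ = trans (ℕP.+-identityʳ _) (ℕP.+-identityʳ _)
boundedVecs-compositionSum zero    b (suc t) g _ = refl
boundedVecs-compositionSum (suc N) b t       g t≤b = begin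
  lsum (map (λ v → indicator (vsum v ℕ.≟ t) * g v)
            (concatMap (λ k → map (k ∷_) (boundedVecs N b)) (List.upTo (suc b))))
    ≡⟨ lsum-concatMap _ (λ k → map (k ∷_) (boundedVecs N b)) (List.upTo (suc b)) ⟩
  lsum (map (λ k → lsum (map (λ v → indicator (vsum v ℕ.≟ t) * g v) (map (k ∷_) (boundedVecs N b))))
            (List.upTo (suc b)))
    ≡⟨ lsum-applyUpTo b _ id ⟩
  sumTo b (λ k → lsum (map (λ v → indicator (vsum v ℕ.≟ t) * g v) (map (k ∷_) (boundedVecs N b))))
    ≡⟨ sumTo-cong b (λ k _ → cong lsum (sym (ListP.map-∘ (boundedVecs N b)))) ⟩
  sumTo b first-entry
    ≡⟨ cong (λ n → sumTo n first-entry) (sym (ℕP.m+[n∸m]≡n t≤b)) ⟩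
  sumTo (t + (b ∸ t)) first-entry
    ≡⟨ sumTo-vanishing-tail t (b ∸ t) (λ k t<k _ → lsum-zero (boundedVecs N b) (λ v →
         cong (_* g (k ∷ v)) (indicator-no (k + vsum v ℕ.≟ t)
           (ℕP.<⇒≱ t<k ∘ (λ k+v≡t → subst (k ≤_) k+v≡t (ℕP.m≤m+n k (vsum v))))))) ⟩
  sumTo t first-entry
    ≡⟨ sumTo-cong t (λ k k≤t → trans (lsum-cong (boundedVecs N b) (λ v → cong (_* g (k ∷ v))
         (indicator-cong-⇔ (k + vsum v ℕ.≟ t) (vsum v ℕ.≟ t ∸ k)
           (λ k+v≡t → trans (sym (ℕP.m+n∸m≡n k (vsum v))) (cong (_∸ k) k+v≡t))
           (vsum-∷ v k≤t))))
         (boundedVecs-compositionSum N b (t ∸ k) (λ v → g (k ∷ v)) (ℕP.≤-trans (ℕP.m∸n≤m t k) t≤b))) ⟩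
  compositionSum (suc N) t g ∎
  where
  open ≡-Reasoning
  first-entry : ℕ → ℕ
  first-entry k = lsum (map (λ v → indicator (k + vsum v ℕ.≟ t) * g (k ∷ v)) (boundedVecs N b))

vprod-map≡0 : ∀ {T} {P : ℕ → Set} {φ : ℕ → ℕ} (v : Vec ℕ N) → (∀ x → P x → x ≤ T → φ x ≡ 0) →
              vsum v ≤ T → Any P v → vprod (Vec.map φ v) ≡ 0
vprod-map≡0 {φ = φ} (x ∷ v) φ≡0 x+v≤T (here px) =
  cong (_* vprod (Vec.map φ v)) (φ≡0 x px (ℕP.m+n≤o⇒m≤o x x+v≤T))
vprod-map≡0 {φ = φ} (x ∷ v) φ≡0 x+v≤T (there pv) =
  trans (cong (φ x *_) (vprod-map≡0 v φ≡0 (ℕP.m+n≤o⇒n≤o x x+v≤T) pv)) (ℕP.*-zeroʳ (φ x))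

vprod-map-map : (f φ ψ : ℕ → ℕ) (v : Vec ℕ N) → (∀ x → φ (f x) ≡ ψ x) →
                vprod (Vec.map φ (Vec.map f v)) ≡ vprod (Vec.map ψ v)
vprod-map-map f φ ψ []      φ∘f≗ψ = refl
vprod-map-map f φ ψ (x ∷ v) φ∘f≗ψ = cong₂ _*_ (φ∘f≗ψ x) (vprod-map-map f φ ψ v φ∘f≗ψ)

2n∸odd : ∀ {n i} → suc (2 * i) ≤ 2 * n → 2 * n ∸ suc (2 * i) ≡ suc (2 * (n ∸ suc i))
2n∸odd {n} {i} 1+2i≤2n = begin
  2 * n ∸ suc (2 * i)                            ≡⟨ cong (λ m → 2 * m ∸ suc (2 * i)) (sym (ℕP.m+[n∸m]≡n i<n)) ⟩
  2 * (suc i + d) ∸ suc (2 * i)                  ≡⟨ cong (_∸ suc (2 * i)) (expand i d) ⟩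
  suc (2 * i) + suc (2 * d) ∸ suc (2 * i)        ≡⟨ ℕP.m+n∸m≡n (suc (2 * i)) (suc (2 * d)) ⟩
  suc (2 * d)                                    ∎
  where
  open ≡-Reasoning
  d : ℕ
  d = n ∸ suc i
  expand : ∀ i d → 2 * (suc i + d) ≡ suc (2 * i) + suc (2 * d)
  expand = ℕSolver.solve-∀
  i<n : i < n
  i<n = ℕP.*-cancelˡ-< 2 i n 1+2i≤2n

closedWalks-odd-gap : ∀ n x → Odd x → x ≤ 2 * n → closedWalks (2 * n ∸ x + 0) ≡ 0
closedWalks-odd-gap n x (i , refl) x≤2n =
  trans (cong closedWalks (trans (ℕP.+-identityʳ _) (2n∸odd {n} {i} x≤2n))) (closedWalks-odd (n ∸ suc i))

closedWalks-even-gap : ∀ n x → closedWalks (2 * n ∸ 2 * x + 0) ≡ (2 * (n ∸ x)) C (n ∸ x)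
closedWalks-even-gap n x =
  trans (cong closedWalks (trans (ℕP.+-identityʳ _) (sym (ℕP.*-distribˡ-∸ 2 n x)))) (closedWalks-even (n ∸ x))

walkTerm : ℕ → Vec ℕ N → ℕ
walkTerm b v = multinomial b v * closedWalkProduct b 0 v

walkTerm≡0 : ∀ {b} {v : Vec ℕ N} → closedWalkProduct b 0 v ≡ 0 → walkTerm b v ≡ 0
walkTerm≡0 {b = b} {v} prod≡0 = trans (cong (multinomial b v *_) prod≡0) (ℕP.*-zeroʳ (multinomial b v))

walkTerm-zero-entry : ∀ n (v : Vec ℕ N) → Any (_≡ 0) v → walkTerm (suc (2 * n)) v ≡ 0
walkTerm-zero-entry n v zero∈v = walkTerm≡0 {b = suc (2 * n)} {v = v} (vprod-map≡0 v
  (λ { x refl _ → trans (cong closedWalks (ℕP.+-identityʳ (suc (2 * n)))) (closedWalks-odd n) }) ℕP.≤-refl zero∈v)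

walkTerm-odd-entry : ∀ n {T} (v : Vec ℕ N) → vsum v ≤ T → T ≤ 2 * n → Any Odd v →
                     walkTerm (suc (2 * n)) (Vec.map suc v) ≡ 0
walkTerm-odd-entry n v v≤T T≤2n odd∈v = walkTerm≡0 {b = suc (2 * n)} {v = Vec.map suc v}
  (trans (vprod-map-map suc (λ x → closedWalks (suc (2 * n) ∸ x + 0)) (λ x → closedWalks (2 * n ∸ x + 0)) v
                        (λ _ → refl))
         (vprod-map≡0 v (λ x odd x≤T → closedWalks-odd-gap n x odd (ℕP.≤-trans x≤T T≤2n)) v≤T odd∈v))

evenTerm oddTerm : ℕ → Vec ℕ N → ℕ
evenTerm n k = multinomial (2 * n) (Vec.map (2 *_) k) * centralProd n k
oddTerm  n k = multinomial (suc (2 * n)) (Vec.map (λ kᵢ → suc (2 * kᵢ)) k) * centralProd n k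

evenSum≡compositionSum : ∀ N n → evenSum N n ≡ compositionSum N n (evenTerm n)
evenSum≡compositionSum N n = trans (lsum-filter (λ k → vsum k ℕ.≟ n) (evenTerm n) (boundedVecs N n))
                                   (boundedVecs-compositionSum N n n (evenTerm n) ℕP.≤-refl)

oddSum≡compositionSum : ∀ M n → M ≤ n → oddSum M n ≡ compositionSum (suc (2 * M)) (n ∸ M) (oddTerm n)
oddSum≡compositionSum M n M≤n = begin
  oddSum M n
    ≡⟨ lsum-filter (λ k → vsum k + M ℕ.≟ n) (oddTerm n) (boundedVecs (suc (2 * M)) n) ⟩
  lsum (map (λ k → indicator (vsum k + M ℕ.≟ n) * oddTerm n k) (boundedVecs (suc (2 * M)) n))
    ≡⟨ lsum-cong (boundedVecs (suc (2 * M)) n) (λ k → cong (_* oddTerm n k)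
         (indicator-cong-⇔ (vsum k + M ℕ.≟ n) (vsum k ℕ.≟ n ∸ M)
           (λ k+M≡n → ℕP.+-cancelʳ-≡ M (vsum k) (n ∸ M) (trans k+M≡n (sym (ℕP.m∸n+n≡m M≤n))))
           (λ k≡n∸M → trans (cong (_+ M) k≡n∸M) (ℕP.m∸n+n≡m M≤n)))) ⟩
  lsum (map (λ k → indicator (vsum k ℕ.≟ n ∸ M) * oddTerm n k) (boundedVecs (suc (2 * M)) n))
    ≡⟨ boundedVecs-compositionSum (suc (2 * M)) n (n ∸ M) (oddTerm n) (ℕP.m∸n≤m n M) ⟩
  compositionSum (suc (2 * M)) (n ∸ M) (oddTerm n) ∎
  where open ≡-Reasoning

oddSum-vanishes : ∀ M n → n < M → oddSum M n ≡ 0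
oddSum-vanishes M n n<M =
  trans (lsum-filter (λ k → vsum k + M ℕ.≟ n) (oddTerm n) (boundedVecs (suc (2 * M)) n))
        (lsum-zero (boundedVecs (suc (2 * M)) n) (λ k → cong (_* oddTerm n k)
          (indicator-no (vsum k + M ℕ.≟ n)
            (λ k+M≡n → ℕP.<⇒≱ n<M (subst (M ≤_) k+M≡n (ℕP.m≤n+m M (vsum k)))))))

multinomialWalkSum-even : ∀ N n → multinomialWalkSum N (2 * n) 0 ≡ evenSum N n
multinomialWalkSum-even N n = begin
  compositionSum N (2 * n) (walkTerm (2 * n))
    ≡⟨ compositionSum-double N n (λ v vsum≡2n odd∈v → walkTerm≡0 {v = v}
         (vprod-map≡0 v (closedWalks-odd-gap n) (ℕP.≤-reflexive vsum≡2n) odd∈v)) ⟩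
  compositionSum N n (walkTerm (2 * n) ∘ Vec.map (2 *_))
    ≡⟨ compositionSum-cong N n (λ k _ → cong (multinomial (2 * n) (Vec.map (2 *_) k) *_)
         (vprod-map-map (2 *_) _ _ k (closedWalks-even-gap n))) ⟩
  compositionSum N n (evenTerm n)
    ≡⟨ sym (evenSum≡compositionSum N n) ⟩
  evenSum N n ∎
  where open ≡-Reasoning

multinomialWalkSum-odd-fewer-than-parts : ∀ N n → suc (2 * n) < N → multinomialWalkSum N (suc (2 * n)) 0 ≡ 0
multinomialWalkSum-odd-fewer-than-parts N n =
  compositionSum-fewer-than-parts N (suc (2 * n)) (λ v _ → walkTerm-zero-entry n v)

multinomialWalkSum-odd-positive : ∀ N n t → t + N ≡ suc (2 * n) →
  multinomialWalkSum N (suc (2 * n)) 0 ≡ compositionSum N t (walkTerm (suc (2 * n)) ∘ Vec.map suc)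
multinomialWalkSum-odd-positive N n t t+N≡ =
  trans (cong (λ m → compositionSum N m (walkTerm (suc (2 * n)))) (sym t+N≡))
        (compositionSum-positive N t (λ v _ zero∈v → walkTerm-zero-entry n v zero∈v))

multinomialWalkSum-odd : ∀ N n s → 2 * s + suc N ≡ suc (2 * n) →
                         multinomialWalkSum (suc N) (suc (2 * n)) 0 ≡ compositionSum (suc N) s (oddTerm n)
multinomialWalkSum-odd N n s 2s+1+N≡ = begin
  multinomialWalkSum (suc N) (suc (2 * n)) 0
    ≡⟨ multinomialWalkSum-odd-positive (suc N) n (2 * s) 2s+1+N≡ ⟩
  compositionSum (suc N) (2 * s) (walkTerm (suc (2 * n)) ∘ Vec.map suc)
    ≡⟨ compositionSum-double (suc N) s (λ v vsum≡2s → walkTerm-odd-entry n v (ℕP.≤-reflexive vsum≡2s) 2s≤2n) ⟩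
  compositionSum (suc N) s (walkTerm (suc (2 * n)) ∘ Vec.map suc ∘ Vec.map (2 *_))
    ≡⟨ compositionSum-cong (suc N) s (λ k _ → cong₂ _*_
         (cong (multinomial (suc (2 * n))) (sym (VecP.map-∘ suc (2 *_) k)))
         (trans (vprod-map-map suc (λ x → closedWalks (suc (2 * n) ∸ x + 0)) (λ x → closedWalks (2 * n ∸ x + 0))
                               (Vec.map (2 *_) k) (λ _ → refl))
                (vprod-map-map (2 *_) _ _ k (closedWalks-even-gap n)))) ⟩
  compositionSum (suc N) s (oddTerm n) ∎
  where
  open ≡-Reasoning
  2s≤2n : 2 * s ≤ 2 * n
  2s≤2n = subst (2 * s ≤_) (ℕP.suc-injective (trans (sym (ℕP.+-suc (2 * s) N)) 2s+1+N≡)) (ℕP.m≤m+n (2 * s) N)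

multinomialWalkSum-odd-oddParts : ∀ M n → multinomialWalkSum (suc (2 * M)) (suc (2 * n)) 0 ≡ oddSum M n
multinomialWalkSum-odd-oddParts M n with M ℕ.≤? n
... | yes M≤n = trans (multinomialWalkSum-odd (2 * M) n (n ∸ M) 2[n∸M]+1+2M≡)
                      (sym (oddSum≡compositionSum M n M≤n))
  where
  2[n∸M]+1+2M≡ : 2 * (n ∸ M) + suc (2 * M) ≡ suc (2 * n)
  2[n∸M]+1+2M≡ = trans (ℕP.+-suc (2 * (n ∸ M)) (2 * M))
    (cong suc (trans (sym (ℕP.*-distribˡ-+ 2 (n ∸ M) M)) (cong (2 *_) (ℕP.m∸n+n≡m M≤n))))
... | no  M≰n = trans (multinomialWalkSum-odd-fewer-than-parts (suc (2 * M)) n (s≤s (ℕP.*-monoʳ-< 2 n<M)))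
                      (sym (oddSum-vanishes M n n<M))
  where
  n<M : n < M
  n<M = ℕP.≰⇒> M≰n

multinomialWalkSum-odd-evenParts : ∀ N M n → suc N ≡ 2 * M → multinomialWalkSum (suc N) (suc (2 * n)) 0 ≡ 0
multinomialWalkSum-odd-evenParts N M n 1+N≡2M with suc (2 * n) ℕ.<? suc N
... | yes 1+2n<1+N = multinomialWalkSum-odd-fewer-than-parts (suc N) n 1+2n<1+N
... | no  1+2n≮1+N = excess-odd (even⊎odd t)
  where
  t : ℕ
  t = suc (2 * n) ∸ suc N
  t+1+N≡ : t + suc N ≡ suc (2 * n)
  t+1+N≡ = ℕP.m∸n+n≡m (ℕP.≮⇒≥ 1+2n≮1+N)
  t≤2n : t ≤ 2 * n
  t≤2n = subst (t ≤_) (ℕP.suc-injective (trans (sym (ℕP.+-suc t N)) t+1+N≡)) (ℕP.m≤m+n t N)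
  excess-odd : (∃ λ i → t ≡ 2 * i) ⊎ (∃ λ i → t ≡ suc (2 * i)) →
               multinomialWalkSum (suc N) (suc (2 * n)) 0 ≡ 0
  excess-odd (inj₁ (i , t≡2i)) = contradiction
    (trans (ℕP.*-distribˡ-+ 2 i M) (trans (cong₂ _+_ (sym t≡2i) (sym 1+N≡2M)) t+1+N≡)) (ℕP.even≢odd (i + M) n)
  excess-odd (inj₂ (i , t≡1+2i)) = begin
    multinomialWalkSum (suc N) (suc (2 * n)) 0
      ≡⟨ multinomialWalkSum-odd-positive (suc N) n t t+1+N≡ ⟩
    compositionSum (suc N) t (walkTerm (suc (2 * n)) ∘ Vec.map suc)
      ≡⟨ cong (λ m → compositionSum (suc N) m (walkTerm (suc (2 * n)) ∘ Vec.map suc)) t≡1+2i ⟩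
    compositionSum (suc N) (suc (2 * i)) (walkTerm (suc (2 * n)) ∘ Vec.map suc)
      ≡⟨ compositionSum-odd-total (suc N) i (λ v vsum≡ → walkTerm-odd-entry n v
           (ℕP.≤-reflexive (trans vsum≡ (sym t≡1+2i))) t≤2n) ⟩
    0 ∎
    where open ≡-Reasoning

open import Data.Integer using (+_)

-- The hypothesis 2 ≤ N only serves to exclude N = 0; the formulas hold for N = 1 as well.
theorem4p1 : (N : ℕ) → 2 ≤ N →
    ((n : ℕ) → r N (2 * n) ≡ + evenSum N n)
    × ((M : ℕ) → N ≡ 2 * M → (n : ℕ) → r N (suc (2 * n)) ≡ + 0)
    × ((M : ℕ) → N ≡ suc (2 * M) → (n : ℕ) → r N (suc (2 * n)) ≡ + oddSum M n)
theorem4p1 (suc N) _ =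
    (λ n → trans (r≡multinomialWalkSum N (2 * n)) (cong +_ (multinomialWalkSum-even (suc N) n)))
  , (λ M 1+N≡2M n → trans (r≡multinomialWalkSum N (suc (2 * n)))
                          (cong +_ (multinomialWalkSum-odd-evenParts N M n 1+N≡2M)))
  , (λ { M refl n → trans (r≡multinomialWalkSum (2 * M) (suc (2 * n)))
                          (cong +_ (multinomialWalkSum-odd-oddParts M n)) })
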